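{- Let $P$ be a graded poset of rank $d+1$ and let $j\ge-1$ be an integer. The following are equivalent: (1) $P$ is $j$-Sing; (2) the reduced order complex $O(P)$ is a $j$-singular complex; (3) for every chain $\hat0=t_0<t_1<\cdots<t_{i-1}<t_i=\hat1$ in $P$ with $i>j+1$, the chain error $\varepsilon_P(\{t_1,\ldots,t_{i-1}\})=0$.
   Context: Posets are finite and graded with unique $\hat0$, $\hat1$, rank function $\rho$ and Möbius function $\mu_P$; the length of $[s,t]$ is $\rho(t)-\rho(s)$, and an interval is regarded as a graded poset of rank equal to its length. $P$ is Eulerian if $\mu_P(s,t)=(-1)^{\rho(t)-\rho(s)}$ for all $s\le t$, and semi-Eulerian if this holds for all intervals $[s,t]\ne[\hat0,\hat1]$. For $P$ of rank $d+1$: $P$ is $(-1)$-Sing if Eulerian, $0$-Sing if semi-Eulerian, and for $j\ge1$, $P$ is $j$-Sing if every interval of $P$ of length $\le d$ is $(j-1)$-Sing. The reduced order complex $O(P)$ has vertex set $P\setminus\{\hat0,\hat1\}$ and faces the chains in $P\setminus\{\hat0,\hat1\}$; it has dimension $d-1$. For a pure $(d-1)$-dimensional complex $\Delta$, with $\mathrm{lk}_\Delta F=\{G:F\cup G\in\Delta,F\cap G=\emptyset\}$ and $\tilde\chi=\sum_{i\ge-1}(-1)^if_i$, set $\varepsilon_\Delta(F)=\tilde\chi(\mathrm{lk}_\Delta F)-(-1)^{d-1-|F|}$; $\Delta$ is $j$-singular if $\varepsilon_\Delta(F)=0$ for every face $F$ with $\dim F=|F|-1\ge j$. For a chain $C=\{t_1<\cdots<t_k\}$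 in $P\setminus\{\hat0,\hat1\}$, $\mu_P(C)=\mu_P(\hat0,t_1)\mu_P(t_1,t_2)\cdots\mu_P(t_k,\hat1)$ and $\varepsilon_P(C)=(-1)^{|C|}[\mu_P(C)-(-1)^{d+1}]$. -}

module Defs where

open import Data.Nat as ℕ using (ℕ; zero; suc)
open import Data.Integer as ℤ using (ℤ; +_; -[1+_])
open import Data.Bool using (Bool; true; false; T; not; _∧_; _∨_; if_then_else_)
open import Data.Fin using (Fin)
open import Data.Fin.Properties using () renaming (_≟_ to _≟ᶠ_)
open import Data.Fin.Subset using (Subset; _∪_; ∣_∣)
open import Data.Vec using (Vec; []; _∷_; lookup)
open import Data.List using (List; []; _∷_; _++_; map; foldr; length)
open import Data.Bool.ListAction using (and)
open import Data.List using () renaming (allFin to allFinL)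
open import Data.Product using (_×_; Σ)
open import Data.Sum using (_⊎_)
open import Data.Empty using (⊥)
open import Relation.Nullary using (¬_; Dec; yes; no)
open import Relation.Nullary.Decidable using (⌊_⌋)
open import Relation.Binary using (Decidable)
open import Relation.Binary.PropositionalEquality using (_≡_; _≢_)

sgn : ℕ → ℤ
sgn zero    = + 1
sgn (suc k) = ℤ.- sgn k

-- (-1)^m for m : ℤ   (note (-1)^(-m) = (-1)^m)
sgnℤ : ℤ → ℤ
sgnℤ (+ k)    = sgn k
sgnℤ -[1+ k ] = sgn (suc k)

sumℤ : List ℤ → ℤ
sumℤ = foldr ℤ._+_ (+ 0)

record FinGradedPoset : Set₁ where
  field
    n        : ℕ
    _≼_      : Fin n → Fin n → Set
    _≼?_     : Decidable _≼_
    ≼-refl   : ∀ x → x ≼ x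
    ≼-antisym : ∀ {x y} → x ≼ y → y ≼ x → x ≡ y
    ≼-trans  : ∀ {x y z} → x ≼ y → y ≼ z → x ≼ z
    0̂        : Fin n
    1̂        : Fin n
    0̂-min    : ∀ x → 0̂ ≼ x
    1̂-max    : ∀ x → x ≼ 1̂
    ρ        : Fin n → ℕ
    ρ-0̂      : ρ 0̂ ≡ 0
    ρ-cover  : ∀ x y → x ≼ y → x ≢ y →
               (∀ z → x ≼ z → z ≼ y → z ≡ x ⊎ z ≡ y) →
               ρ y ≡ suc (ρ x)

module _ (P : FinGradedPoset) where
  open FinGradedPoset P

  _≺_ : Fin n → Fin n → Set
  x ≺ y = x ≼ y × x ≢ y

  allFin : List (Fin n)
  allFin = allFinL n

  ≼ᵇ : Fin n → Fin n → Bool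
  ≼ᵇ x y = ⌊ x ≼? y ⌋

  ≡ᵇ : Fin n → Fin n → Bool
  ≡ᵇ x y = ⌊ x ≟ᶠ y ⌋

  -- The fuel argument bounds the recursion depth; fuel n suffices since
  -- every strict chain in P has fewer than n steps.

  mobiusFuel : ℕ → Fin n → Fin n → ℤ
  mobiusFuel f s t with s ≟ᶠ t
  ... | yes _ = + 1
  mobiusFuel zero    s t | no _ = + 0
  mobiusFuel (suc f) s t | no _ =
    if ≼ᵇ s t
    then ℤ.- sumℤ (map (λ u → if ≼ᵇ s u ∧ ≼ᵇ u t ∧ not (≡ᵇ u t)
                               then mobiusFuel f s u else + 0) allFin)
    else + 0

  μ : Fin n → Fin n → ℤ
  μ = mobiusFuel n

  -- Eulerian / semi-Eulerian / j-Sing for the interval [s,t] of P,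
  -- regarded as a graded poset (its Möbius function is μ restricted to
  -- [s,t], its rank differences are those of ρ).

  EulerianInt : Fin n → Fin n → Set
  EulerianInt s t = ∀ a b → s ≼ a → a ≼ b → b ≼ t →
    μ a b ≡ sgn (ρ b ℕ.∸ ρ a)

  SemiEulerianInt : Fin n → Fin n → Set
  SemiEulerianInt s t = ∀ a b → s ≼ a → a ≼ b → b ≼ t →
    ¬ (a ≡ s × b ≡ t) → μ a b ≡ sgn (ρ b ℕ.∸ ρ a)

  -- SingK k s t  means  "[s,t] is (k-1)-Sing".
  SingK : ℕ → Fin n → Fin n → Set
  SingK zero          s t = EulerianInt s t
  SingK (suc zero)    s t = SemiEulerianInt s t
  SingK (suc (suc k)) s t = ∀ a b → s ≼ a → a ≼ b → b ≼ t →
    (ρ b ℕ.∸ ρ a) ℕ.< (ρ t ℕ.∸ ρ s) → SingK (suc k) a b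

  -- P is j-Sing (j ≥ -1; the value for j < -1 is irrelevant).
  Sing : ℤ → Set
  Sing (+ k)          = SingK (suc k) 0̂ 1̂
  Sing -[1+ zero ]    = SingK zero 0̂ 1̂
  Sing -[1+ suc _ ]   = ⊥

  -- Reduced order complex O(P): faces are subsets of P ∖ {0̂,1̂} that are
  -- chains (pairwise comparable).

  allSubsets : (m : ℕ) → List (Subset m)
  allSubsets zero    = [] ∷ []
  allSubsets (suc m) = map (false ∷_) (allSubsets m) ++ map (true ∷_) (allSubsets m)

  isFaceᵇ : Subset n → Bool
  isFaceᵇ G = and (map (λ x → not (lookup G x) ∨
      (not (≡ᵇ x 0̂) ∧ not (≡ᵇ x 1̂) ∧
       and (map (λ y → not (lookup G y) ∨ ≼ᵇ x y ∨ ≼ᵇ y x) allFin))) allFin)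

  IsFace : Subset n → Set
  IsFace G = T (isFaceᵇ G)

  disjointᵇ : Subset n → Subset n → Bool
  disjointᵇ F G = and (map (λ x → not (lookup F x ∧ lookup G x)) allFin)

  inLinkᵇ : Subset n → Subset n → Bool
  inLinkᵇ F G = disjointᵇ F G ∧ isFaceᵇ (F ∪ G)

  -- reduced Euler characteristic of lk F:  Σ_{G ∈ lk F} (-1)^{dim G},
  -- dim G = |G| - 1 (the empty face contributes -1).
  χ̃lk : Subset n → ℤ
  χ̃lk F = sumℤ (map (λ G → if inLinkᵇ F G then sgnℤ (+ ∣ G ∣ ℤ.- + 1) else + 0)
                     (allSubsets n))

  -- ε_O(P)(F) = χ̃(lk F) - (-1)^{d-1-|F|}, where P has rank d+1
  εΔ : ℕ → Subset n → ℤ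
  εΔ d F = χ̃lk F ℤ.- sgnℤ (+ d ℤ.- + 1 ℤ.- + ∣ F ∣)

  JSingularOP : ℕ → ℤ → Set
  JSingularOP d j = ∀ F → IsFace F → j ℤ.≤ (+ ∣ F ∣ ℤ.- + 1) → εΔ d F ≡ + 0

  -- Chains a = t₀ < t₁ < ⋯ < t_{i-1} < t_i = b, with the inner elements
  -- t₁ … t_{i-1} given as a list.

  StrictChain : Fin n → List (Fin n) → Fin n → Set
  StrictChain a []       b = a ≺ b
  StrictChain a (x ∷ xs) b = a ≺ x × StrictChain x xs b

  μChain : Fin n → List (Fin n) → Fin n → ℤ
  μChain a []       b = μ a b
  μChain a (x ∷ xs) b = μ a x ℤ.* μChain x xs b

  εP : ℕ → List (Fin n) → ℤ
  εP d C = sgn (length C) ℤ.* (μChain 0̂ C 1̂ ℤ.- sgn (suc d))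

  -- condition (3): every chain 0̂ = t₀ < ⋯ < t_i = 1̂ with i > j+1
  -- has ε_P({t₁,…,t_{i-1}}) = 0   (here i = length C + 1)
  ChainCondition : ℕ → ℤ → Set
  ChainCondition d j = ∀ (C : List (Fin n)) → StrictChain 0̂ C 1̂ →
    j ℤ.+ + 1 ℤ.< + suc (length C) → εP d C ≡ + 0

-- Write D = d + 1 for the rank of P.  Unwinding the recursive definition, P is j-Sing exactly
-- when every interval of length at most D - (j + 1) is Eulerian.  A chain 0̂ < t₁ < ⋯ < 1̂ with more
-- than j inner elements cuts [0̂,1̂] into intervals that short, so μ_P(C) = (-1)^D; conversely every
-- such interval [a,b] lies on a chain of this kind that is saturated below a and above b, and each
-- cover there contributes μ = -1.  This is (1) ⇔ (3).
--
-- The faces of O(P) are the sets of inner elements of chains 0̂ < C < 1̂, and a face of lk C is a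
-- choice of chains in the open intervals between consecutive elements of C.  By Philip Hall's
-- theorem the reduced Euler characteristic of the order complex of (x,y) is μ_P(x,y), so that
-- χ̃(lk C) = (-1)^|C| μ_P(C), i.e. ε_O(P)(C) = ε_P(C).  This is (2) ⇔ (3).

module Submission where

open import Defs hiding (_≺_)
import Defs
open import Data.Nat using (ℕ; suc)
open import Data.Integer using (ℤ; -[1+_]; _≤_)
open import Data.Product using (_×_)
open import Function.Bundles using (_⇔_)
open import Relation.Binary.PropositionalEquality using (_≡_)

open import Data.Bool using (Bool; true; false; T; if_then_else_; _∧_; _∨_; not)
open import Data.Bool.ListAction using (and)
open import Data.Bool.Properties using (T-∧; T-∨; T-≡)
open import Data.Empty using (⊥-elim)
open import Data.Fin using (Fin; zero; suc)
open import Data.Fin.Induction using (po-wellFounded; po-noetherian)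
open import Data.Fin.Properties using (punchInᵢ≢i; any?; all?) renaming (_≟_ to _≟ᶠ_)
open import Data.Fin.Subset as Subset
  using (Subset; _∪_; _∩_; _─_; ∁; ⁅_⁆; ∣_∣; _∈_; _∉_; _⊆_; Nonempty; inside; outside)
open import Data.Fin.Subset.Properties
  using ( _⊆?_; _∈?_; ⊆-refl; ⊆-antisym; ⊥⊆; ∉⊥; ∣⊥∣≡0; drop-∷-⊆; ∣p∣≤n; p⊆q⇒∣p∣≤∣q∣; p⊂q⇒∣p∣<∣q∣
        ; x∈⁅x⁆; x∈⁅y⁆⇒x≡y; x∉⁅y⁆⇒x≢y; ∣⁅x⁆∣≡1; x∉p⇒x∈∁p; x∈∁p⇒x∉p
        ; x∈p∪q⁺; x∈p∪q⁻; p⊆p∪q; q⊆p∪q; ∪-assoc; ∪-identityʳ; x∈p∩q⁺; x∈p∩q⁻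
        ; p─q⊆p; x∈p∧x≢y⇒x∈p-y; x∈p⇒∣p-x∣<∣p∣; Empty-unique; nonempty? )
open import Data.Integer using (+_; _+_; _*_; -_; _-_; 0ℤ; 1ℤ; -1ℤ)
import Data.Integer as ℤ
import Data.Integer.Properties as ℤ
open import Data.Integer.Solver using (module +-*-Solver)
open import Data.List using (List; []; _∷_; _++_; length)
import Data.List as List
import Data.List.Properties as List
import Data.Nat as ℕ
import Data.Nat.Induction as ℕ
import Data.Nat.Properties as ℕ
open import Data.Product using (_,_; proj₁; proj₂; ∃-syntax)
open import Data.Product.Function.NonDependent.Propositional using (_×-⇔_)
open import Data.Sum using (_⊎_; inj₁; inj₂; [_,_]′)
import Data.Sum as ⊎
open import Data.Unit using (tt)
open import Data.Vec using ([]; _∷_; lookup; here; there; tabulate)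
open import Data.Vec.Functional using (removeAt)
open import Data.Vec.Properties using (∷-injectiveʳ; lookup∘tabulate; []=⇒lookup; lookup⇒[]=)
open import Function using (_∘_; flip; _⟨_⟩_; Equivalence; mk⇔)
open import Function.Properties.Equivalence using () renaming (trans to ⇔-trans; sym to ⇔-sym)
open import Induction.WellFounded using (WellFounded; Acc; acc)
open import Relation.Binary using (Rel; Decidable; IsPartialOrder)
import Relation.Binary.Construct.Flip.EqAndOrd as Flip
import Relation.Binary.Construct.NonStrictToStrict as ToStrict
open import Relation.Binary.PropositionalEquality using (_≢_; refl; sym; trans; cong; cong₂; module ≡-Reasoning)
import Relation.Binary.PropositionalEquality as ≡
open import Relation.Nullary using (contradiction; ¬_; Dec; yes; no; does; _×-dec_; _⊎-dec_; _→-dec_; ¬?)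
open import Relation.Nullary.Decidable using (decidable-stable; dec-true; toSum; isYes; T?; toWitness; fromWitness)
open import Relation.Unary using (Pred)

open import Algebra.Properties.CommutativeMonoid.Sum ℤ.+-0-commutativeMonoid
  using (sum; sum-syntax; sum-cong-≗; sum-remove; sum-replicate-zero)
open import Algebra.Properties.CommutativeSemigroup ℤ.+-commutativeSemigroup
  using () renaming (interchange to +-interchange)

when : {A : Set} → Dec A → ℤ → ℤ
when a? v = if does a? then v else 0ℤ

module _ {A : Set} where

  when-yes : (a? : Dec A) {v : ℤ} → A → when a? v ≡ v
  when-yes (yes _) _ = refl
  when-yes (no ¬a) a = ⊥-elim (¬a a)

  when-no : (a? : Dec A) {v : ℤ} → ¬ A → when a? v ≡ 0ℤ
  when-no (yes a) ¬a = ⊥-elim (¬a a)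
  when-no (no _)  _  = refl

  when-0 : (a? : Dec A) → when a? 0ℤ ≡ 0ℤ
  when-0 (yes _) = refl
  when-0 (no _)  = refl

  neg-when : (a? : Dec A) {v : ℤ} → - when a? v ≡ when a? (- v)
  neg-when (yes _) = refl
  neg-when (no _)  = refl

module _ {A B : Set} where

  when-cong : (a? : Dec A) (b? : Dec B) {v w : ℤ} →
              (A → B) → (B → A) → (A → v ≡ w) → when a? v ≡ when b? w
  when-cong (yes a) b? A→B _   v≡w = trans (v≡w a) (sym (when-yes b? (A→B a)))
  when-cong (no ¬a) b? _   B→A _   = sym (when-no b? (¬a ∘ B→A))

  when-when : (a? : Dec A) (b? : Dec B) {v : ℤ} → when a? (when b? v) ≡ when (a? ×-dec b?) v
  when-when (yes _) _ = refl
  when-when (no _)  _ = refl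

  when-* : (a? : Dec A) (b? : Dec B) {v w : ℤ} → when a? v * when b? w ≡ when (a? ×-dec b?) (v * w)
  when-* (yes _) (yes _)     = refl
  when-* (yes _) (no _)  {v} = ℤ.*-zeroʳ v
  when-* (no _)  _           = refl

  when-implied : (a? : Dec A) (b? : Dec B) {v : ℤ} → (A → B) → when b? (when a? v) ≡ when a? v
  when-implied (yes a) b? A→B = when-yes b? (A→B a)
  when-implied (no _)  b? _   = when-0 b?

sgn-+ : ∀ a b → sgn (a ℕ.+ b) ≡ sgn a * sgn b
sgn-+ ℕ.zero  b = sym (ℤ.*-identityˡ (sgn b))
sgn-+ (suc a) b = trans (cong -_ (sgn-+ a b)) (ℤ.neg-distribˡ-* (sgn a) (sgn b))

sgn-*-sgn : ∀ a → sgn a * sgn a ≡ 1ℤ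
sgn-*-sgn ℕ.zero  = refl
sgn-*-sgn (suc a) = begin
  - sgn a * - sgn a     ≡⟨ ℤ.neg-distribˡ-* (sgn a) (- sgn a) ⟨
  - (sgn a * - sgn a)   ≡⟨ cong -_ (ℤ.neg-distribʳ-* (sgn a) (sgn a)) ⟨
  - - (sgn a * sgn a)   ≡⟨ ℤ.neg-involutive _ ⟩
  sgn a * sgn a         ≡⟨ sgn-*-sgn a ⟩
  1ℤ                    ∎
  where open ≡-Reasoning

sgn-*-cancelˡ : ∀ a {v w} → sgn a * v ≡ sgn a * w → v ≡ w
sgn-*-cancelˡ a {v} {w} eq = begin
  v                   ≡⟨ ℤ.*-identityˡ v ⟨
  1ℤ * v              ≡⟨ cong (_* v) (sgn-*-sgn a) ⟨
  sgn a * sgn a * v   ≡⟨ ℤ.*-assoc (sgn a) (sgn a) v ⟩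
  sgn a * (sgn a * v) ≡⟨ cong (sgn a *_) eq ⟩
  sgn a * (sgn a * w) ≡⟨ ℤ.*-assoc (sgn a) (sgn a) w ⟨
  sgn a * sgn a * w   ≡⟨ cong (_* w) (sgn-*-sgn a) ⟩
  1ℤ * w              ≡⟨ ℤ.*-identityˡ w ⟩
  w                   ∎
  where open ≡-Reasoning

sgn-*-cancelʳ : ∀ a {v w} → v * sgn a ≡ w * sgn a → v ≡ w
sgn-*-cancelʳ a {v} {w} eq = sgn-*-cancelˡ a (trans (ℤ.*-comm (sgn a) v) (trans eq (ℤ.*-comm w (sgn a))))

sgn-pred : ∀ {a} → 1 ℕ.≤ a → sgn a ≡ - sgn (a ℕ.∸ 1)
sgn-pred {suc a} _ = refl

sgnℤ-pred : ∀ i → sgnℤ (i - + 1) ≡ - sgnℤ i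
sgnℤ-pred (+ ℕ.zero)  = refl
sgnℤ-pred (+ suc a)   = sym (ℤ.neg-involutive (sgn a))
sgnℤ-pred -[1+ a ]    = cong (λ k → sgn (suc (suc k))) (ℕ.+-identityʳ a)

sgnℤ-∸ : ∀ i k → sgnℤ (i - + k) ≡ sgnℤ i * sgn k
sgnℤ-∸ i ℕ.zero  = trans (cong sgnℤ (ℤ.+-identityʳ i)) (sym (ℤ.*-identityʳ (sgnℤ i)))
sgnℤ-∸ i (suc k) = begin
  sgnℤ (i - + suc k)         ≡⟨ cong sgnℤ (shift i (+ k)) ⟩
  sgnℤ (i - + k - + 1)       ≡⟨ sgnℤ-pred (i - + k) ⟩
  - sgnℤ (i - + k)           ≡⟨ cong -_ (sgnℤ-∸ i k) ⟩
  - (sgnℤ i * sgn k)         ≡⟨ ℤ.neg-distribʳ-* (sgnℤ i) (sgn k) ⟩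
  sgnℤ i * sgn (suc k)       ∎
  where
  open ≡-Reasoning
  shift : ∀ i j → i - (1ℤ + j) ≡ i - j - 1ℤ
  shift = solve 2 (λ i j → i :- (con 1ℤ :+ j) := (i :- j) :- con 1ℤ) refl
    where open +-*-Solver

dim≥⇔length> : ∀ {j} → -[1+ 0 ] ≤ j → ∀ c → (j ≤ + c - 1ℤ) ⇔ (j + 1ℤ ℤ.< + suc c)
dim≥⇔length> { -[1+ 0 ]}     _ ℕ.zero  = mk⇔ (λ _ → ℤ.+<+ ℕ.z<s) (λ _ → ℤ.≤-refl)
dim≥⇔length> { -[1+ 0 ]}     _ (suc c) = mk⇔ (λ _ → ℤ.+<+ ℕ.z<s) (λ _ → ℤ.-≤+)
dim≥⇔length> { -[1+ suc _ ]} (ℤ.-≤- ())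
dim≥⇔length> {+ i}           _ ℕ.zero  =
  mk⇔ (λ ()) (λ { (ℤ.+<+ (ℕ.s≤s i+1≤0)) → contradiction (ℕ.m+n≤o⇒n≤o i i+1≤0) λ () })
dim≥⇔length> {+ i}           _ (suc c) = mk⇔
  (λ { (ℤ.+≤+ i≤c) → ℤ.+<+ (ℕ.s≤s (ℕ.≤-trans (ℕ.≤-reflexive (ℕ.+-comm i 1)) (ℕ.s≤s i≤c))) })
  (λ { (ℤ.+<+ (ℕ.s≤s i+1≤1+c)) → ℤ.+≤+ (ℕ.≤-pred (ℕ.≤-trans (ℕ.≤-reflexive (ℕ.+-comm 1 i)) i+1≤1+c)) })

∸-split : ∀ a b k → 1 ℕ.≤ a → k ℕ.≤ b → (a ℕ.+ b) ℕ.∸ suc k ≡ (a ℕ.∸ 1) ℕ.+ (b ℕ.∸ k)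
∸-split (suc a) b k _ k≤b = ℕ.+-∸-assoc a k≤b

∑-unique : ∀ {m} (f : Fin m → ℤ) u → (∀ v → v ≢ u → f v ≡ 0ℤ) → ∑[ v < m ] f v ≡ f u
∑-unique {suc m} f u vanishes = begin
  sum f                    ≡⟨ sum-remove f ⟩
  f u + sum (removeAt f u) ≡⟨ cong (_+_ (f u)) (sum-cong-≗ (λ v → vanishes _ (punchInᵢ≢i u v))) ⟩
  f u + ∑[ v < m ] 0ℤ      ≡⟨ cong (_+_ (f u)) (sum-replicate-zero m) ⟩
  f u + 0ℤ                 ≡⟨ ℤ.+-identityʳ (f u) ⟩
  f u                      ∎
  where open ≡-Reasoning

sumℤ-tabulate : ∀ {m} (f : Fin m → ℤ) → sumℤ (List.tabulate f) ≡ ∑[ i < m ] f i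
sumℤ-tabulate {ℕ.zero}  f = refl
sumℤ-tabulate {suc m}   f = cong (_+_ (f zero)) (sumℤ-tabulate (f ∘ suc))

sumℤ-++ : ∀ xs ys → sumℤ (xs ++ ys) ≡ sumℤ xs + sumℤ ys
sumℤ-++ []       ys = sym (ℤ.+-identityˡ (sumℤ ys))
sumℤ-++ (x ∷ xs) ys = trans (cong (_+_ x) (sumℤ-++ xs ys)) (sym (ℤ.+-assoc x (sumℤ xs) (sumℤ ys)))

∑ₛ : (m : ℕ) → (Subset m → ℤ) → ℤ
∑ₛ ℕ.zero  g = g []
∑ₛ (suc m) g = ∑ₛ m (g ∘ (outside ∷_)) + ∑ₛ m (g ∘ (inside ∷_))

∑ₛ-cong : ∀ m {g h : Subset m → ℤ} → (∀ H → g H ≡ h H) → ∑ₛ m g ≡ ∑ₛ m h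
∑ₛ-cong ℕ.zero  g≗h = g≗h []
∑ₛ-cong (suc m) g≗h = cong₂ _+_ (∑ₛ-cong m (g≗h ∘ (outside ∷_))) (∑ₛ-cong m (g≗h ∘ (inside ∷_)))

∑ₛ-zero : ∀ m → ∑ₛ m (λ _ → 0ℤ) ≡ 0ℤ
∑ₛ-zero ℕ.zero  = refl
∑ₛ-zero (suc m) = cong₂ _+_ (∑ₛ-zero m) (∑ₛ-zero m)

∑ₛ-distrib-+ : ∀ m (g h : Subset m → ℤ) → ∑ₛ m (λ H → g H + h H) ≡ ∑ₛ m g + ∑ₛ m h
∑ₛ-distrib-+ ℕ.zero  g h = refl
∑ₛ-distrib-+ (suc m) g h = trans
  (cong₂ _+_ (∑ₛ-distrib-+ m _ _) (∑ₛ-distrib-+ m _ _))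
  (+-interchange (∑ₛ m _) (∑ₛ m _) (∑ₛ m _) (∑ₛ m _))

neg-∑ₛ : ∀ m (g : Subset m → ℤ) → - ∑ₛ m g ≡ ∑ₛ m (-_ ∘ g)
neg-∑ₛ ℕ.zero  g = refl
neg-∑ₛ (suc m) g = trans (ℤ.neg-distrib-+ (∑ₛ m _) (∑ₛ m _)) (cong₂ _+_ (neg-∑ₛ m _) (neg-∑ₛ m _))

∑ₛ-when : ∀ m {A : Set} (a? : Dec A) (g : Subset m → ℤ) → ∑ₛ m (λ H → when a? (g H)) ≡ when a? (∑ₛ m g)
∑ₛ-when m (yes _) g = refl
∑ₛ-when m (no _)  g = ∑ₛ-zero m

∑ₛ-∑-comm : ∀ m k (f : Fin k → Subset m → ℤ) →
            ∑ₛ m (λ H → ∑[ i < k ] f i H) ≡ ∑[ i < k ] ∑ₛ m (f i)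
∑ₛ-∑-comm m ℕ.zero  f = ∑ₛ-zero m
∑ₛ-∑-comm m (suc k) f =
  trans (∑ₛ-distrib-+ m _ _) (cong (_+_ (∑ₛ m (f zero))) (∑ₛ-∑-comm m k (f ∘ suc)))

∑ₛ-⊥ : ∀ m {g : Subset m → ℤ} → (∀ H → H ≢ Subset.⊥ → g H ≡ 0ℤ) → ∑ₛ m g ≡ g Subset.⊥
∑ₛ-⊥ ℕ.zero  _       = refl
∑ₛ-⊥ (suc m) {g} vanishes = begin
  ∑ₛ m (g ∘ (outside ∷_)) + ∑ₛ m (g ∘ (inside ∷_))
    ≡⟨ cong₂ _+_ (∑ₛ-⊥ m (λ H H≢⊥ → vanishes _ (H≢⊥ ∘ ∷-injectiveʳ)))
                 (trans (∑ₛ-cong m (λ H → vanishes (inside ∷ H) λ ())) (∑ₛ-zero m)) ⟩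
  g Subset.⊥ + 0ℤ ≡⟨ ℤ.+-identityʳ _ ⟩
  g Subset.⊥      ∎
  where open ≡-Reasoning

+∑ₛ-zero : ∀ m a → a + ∑ₛ m (λ _ → 0ℤ) ≡ a
+∑ₛ-zero m a = trans (cong (_+_ a) (∑ₛ-zero m)) (ℤ.+-identityʳ a)

∑ₛ-∪ : ∀ m (K : Subset m) (g : Subset m → ℤ) →
       ∑ₛ m (λ G → when (G ⊆? ∁ K) (g (K ∪ G))) ≡ ∑ₛ m (λ H → when (K ⊆? H) (g H))
∑ₛ-∪ ℕ.zero  []            g = refl
∑ₛ-∪ (suc m) (outside ∷ K) g = cong₂ _+_ (∑ₛ-∪ m K (g ∘ (outside ∷_))) (∑ₛ-∪ m K (g ∘ (inside ∷_)))
∑ₛ-∪ (suc m) (inside  ∷ K) g =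
  trans (cong (_+ ∑ₛ m (λ _ → 0ℤ)) (∑ₛ-∪ m K (g ∘ (inside ∷_)))) (ℤ.+-comm _ (∑ₛ m (λ _ → 0ℤ)))

∑ₛ-∩-* : ∀ m (S T : Subset m) → S ⊆ ∁ T → (f g : Subset m → ℤ) →
         ∑ₛ m (λ H → when (H ⊆? S ∪ T) (f (H ∩ S) * g (H ∩ T))) ≡
         ∑ₛ m (λ H → when (H ⊆? S) (f H)) * ∑ₛ m (λ H → when (H ⊆? T) (g H))
∑ₛ-∩-* ℕ.zero  []            []            _    f g = refl
∑ₛ-∩-* (suc m) (outside ∷ S) (outside ∷ T) S⊆∁T f g = begin
  _                         ≡⟨ cong (_+ ∑ₛ m (λ _ → 0ℤ)) (∑ₛ-∩-* m S T (drop-∷-⊆ S⊆∁T) _ _) ⟩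
  F₀ * G₀ + ∑ₛ m (λ _ → 0ℤ) ≡⟨ +∑ₛ-zero m _ ⟩
  F₀ * G₀                   ≡⟨ cong₂ _*_ (+∑ₛ-zero m F₀) (+∑ₛ-zero m G₀) ⟨
  (F₀ + ∑ₛ m (λ _ → 0ℤ)) * (G₀ + ∑ₛ m (λ _ → 0ℤ)) ∎
  where
  open ≡-Reasoning
  F₀ = ∑ₛ m (λ H → when (H ⊆? S) (f (outside ∷ H)))
  G₀ = ∑ₛ m (λ H → when (H ⊆? T) (g (outside ∷ H)))
∑ₛ-∩-* (suc m) (inside  ∷ S) (outside ∷ T) S⊆∁T f g = begin
  _                 ≡⟨ cong₂ _+_ (∑ₛ-∩-* m S T (drop-∷-⊆ S⊆∁T) _ _) (∑ₛ-∩-* m S T (drop-∷-⊆ S⊆∁T) _ _) ⟩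
  F₀ * G₀ + F₁ * G₀ ≡⟨ ℤ.*-distribʳ-+ G₀ F₀ F₁ ⟨
  (F₀ + F₁) * G₀    ≡⟨ cong (_*_ (F₀ + F₁)) (+∑ₛ-zero m G₀) ⟨
  (F₀ + F₁) * (G₀ + ∑ₛ m (λ _ → 0ℤ)) ∎
  where
  open ≡-Reasoning
  F₀ = ∑ₛ m (λ H → when (H ⊆? S) (f (outside ∷ H)))
  F₁ = ∑ₛ m (λ H → when (H ⊆? S) (f (inside ∷ H)))
  G₀ = ∑ₛ m (λ H → when (H ⊆? T) (g (outside ∷ H)))
∑ₛ-∩-* (suc m) (outside ∷ S) (inside  ∷ T) S⊆∁T f g = begin
  _                 ≡⟨ cong₂ _+_ (∑ₛ-∩-* m S T (drop-∷-⊆ S⊆∁T) _ _) (∑ₛ-∩-* m S T (drop-∷-⊆ S⊆∁T) _ _) ⟩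
  F₀ * G₀ + F₀ * G₁ ≡⟨ ℤ.*-distribˡ-+ F₀ G₀ G₁ ⟨
  F₀ * (G₀ + G₁)    ≡⟨ cong (_* (G₀ + G₁)) (+∑ₛ-zero m F₀) ⟨
  (F₀ + ∑ₛ m (λ _ → 0ℤ)) * (G₀ + G₁) ∎
  where
  open ≡-Reasoning
  F₀ = ∑ₛ m (λ H → when (H ⊆? S) (f (outside ∷ H)))
  G₀ = ∑ₛ m (λ H → when (H ⊆? T) (g (outside ∷ H)))
  G₁ = ∑ₛ m (λ H → when (H ⊆? T) (g (inside ∷ H)))
∑ₛ-∩-* (suc m) (inside  ∷ S) (inside  ∷ T) S⊆∁T f g with () ← S⊆∁T here

setOf : ∀ {m p} {Q : Pred (Fin m) p} → (∀ x → Dec (Q x)) → Subset m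
setOf Q? = tabulate (does ∘ Q?)

module _ {m p} {Q : Pred (Fin m) p} (Q? : ∀ x → Dec (Q x)) {x : Fin m} where

  ∈-setOf⁺ : Q x → x ∈ setOf Q?
  ∈-setOf⁺ Qx = lookup⇒[]= x _ (trans (lookup∘tabulate _ x) (dec-true (Q? x) Qx))

  ∈-setOf⁻ : x ∈ setOf Q? → Q x
  ∈-setOf⁻ x∈ with Q? x | trans (sym (lookup∘tabulate (does ∘ Q?) x)) ([]=⇒lookup x∈)
  ... | yes Qx | _ = Qx

∣∪∣-disjoint : ∀ {m} (p q : Subset m) → p ⊆ ∁ q → ∣ p ∪ q ∣ ≡ ∣ p ∣ ℕ.+ ∣ q ∣
∣∪∣-disjoint []            []            _ = refl
∣∪∣-disjoint (outside ∷ p) (outside ∷ q) d = ∣∪∣-disjoint p q (drop-∷-⊆ d)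
∣∪∣-disjoint (outside ∷ p) (inside  ∷ q) d = trans (cong suc (∣∪∣-disjoint p q (drop-∷-⊆ d))) (sym (ℕ.+-suc _ _))
∣∪∣-disjoint (inside  ∷ p) (outside ∷ q) d = cong suc (∣∪∣-disjoint p q (drop-∷-⊆ d))
∣∪∣-disjoint (inside  ∷ p) (inside  ∷ q) d with () ← d here

∣∩∣-split : ∀ {m} (p q r : Subset m) → p ⊆ q ∪ r → q ⊆ ∁ r → ∣ p ∣ ≡ ∣ p ∩ q ∣ ℕ.+ ∣ p ∩ r ∣
∣∩∣-split []            []            []            _   _ = refl
∣∩∣-split (outside ∷ p) (_       ∷ q) (_       ∷ r) p⊆ q⊆ = ∣∩∣-split p q r (drop-∷-⊆ p⊆) (drop-∷-⊆ q⊆)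
∣∩∣-split (inside  ∷ p) (inside  ∷ q) (outside ∷ r) p⊆ q⊆ = cong suc (∣∩∣-split p q r (drop-∷-⊆ p⊆) (drop-∷-⊆ q⊆))
∣∩∣-split (inside  ∷ p) (outside ∷ q) (inside  ∷ r) p⊆ q⊆ =
  trans (cong suc (∣∩∣-split p q r (drop-∷-⊆ p⊆) (drop-∷-⊆ q⊆))) (sym (ℕ.+-suc _ _))
∣∩∣-split (inside  ∷ p) (inside  ∷ q) (inside  ∷ r) _   q⊆ with () ← q⊆ here
∣∩∣-split (inside  ∷ p) (outside ∷ q) (outside ∷ r) p⊆  _ with () ← p⊆ here

⁅⁆⊆ : ∀ {m} {u : Fin m} {H} → u ∈ H → ⁅ u ⁆ ⊆ H
⁅⁆⊆ {u = u} {H} u∈H h∈⁅u⁆ = ≡.subst (_∈ H) (sym (x∈⁅y⁆⇒x≡y u h∈⁅u⁆)) u∈H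

∈-⁅⁆∪⁻ : ∀ {m} {x h : Fin m} {p} → h ∈ ⁅ x ⁆ ∪ p → h ≡ x ⊎ h ∈ p
∈-⁅⁆∪⁻ {x = x} {p = p} h∈ = ⊎.map₁ (x∈⁅y⁆⇒x≡y x) (x∈p∪q⁻ ⁅ x ⁆ p h∈)

⁅x⁆∪[p-x]≡p : ∀ {m} {x : Fin m} {p} → x ∈ p → ⁅ x ⁆ ∪ (p ─ ⁅ x ⁆) ≡ p
⁅x⁆∪[p-x]≡p {x = x} {p} x∈p = ⊆-antisym
  (λ h∈ → [ (λ { refl → x∈p }) , p─q⊆p p ⁅ x ⁆ ]′ (∈-⁅⁆∪⁻ h∈))
  (λ {h} h∈p → x∈p∪q⁺ (⊎.map (λ { refl → x∈⁅x⁆ x }) (x∈p∧x≢y⇒x∈p-y h∈p) (toSum (h ≟ᶠ x))))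

∈⇒∣∣-pos : ∀ {m} {x : Fin m} {p} → x ∈ p → 1 ℕ.≤ ∣ p ∣
∈⇒∣∣-pos x∈p = ℕ.≤-trans (ℕ.s≤s ℕ.z≤n) (x∈p⇒∣p-x∣<∣p∣ x∈p)

≢⊥⇒nonempty : ∀ {m} {p : Subset m} → p ≢ Subset.⊥ → Nonempty p
≢⊥⇒nonempty {p = p} p≢⊥ = decidable-stable (nonempty? p) (p≢⊥ ∘ Empty-unique)

fromList : ∀ {m} → List (Fin m) → Subset m
fromList []      = Subset.⊥
fromList (c ∷ C) = ⁅ c ⁆ ∪ fromList C

∈─⇒∉ : ∀ {m} {x : Fin m} (p q : Subset m) → x ∈ p ─ q → x ∉ q
∈─⇒∉ (inside  ∷ p) (outside ∷ q) here       ()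
∈─⇒∉ (_       ∷ p) (_       ∷ q) (there x∈) (there x∈q) = ∈─⇒∉ p q x∈ x∈q

T-not : ∀ {b} → T (not b) ⇔ (¬ T b)
T-not {true}  = mk⇔ (λ ()) (λ ¬t → ¬t tt)
T-not {false} = mk⇔ (λ _ ()) (λ _ → tt)

T-not-∨ : ∀ {b c} → T (not b ∨ c) ⇔ (T b → T c)
T-not-∨ {true}  = mk⇔ (λ t _ → t) (λ f → f tt)
T-not-∨ {false} = mk⇔ (λ _ ()) (λ _ → tt)

T-isYes : ∀ {A : Set} (a? : Dec A) → T (isYes a?) ⇔ A
T-isYes a? = mk⇔ toWitness fromWitness

T-and-tabulate : ∀ {m} (f : Fin m → Bool) → T (and (List.tabulate f)) ⇔ (∀ i → T (f i))
T-and-tabulate {ℕ.zero} f = mk⇔ (λ _ ()) (λ _ → tt)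
T-and-tabulate {suc m}  f = mk⇔
  (λ t → let head , rest = Equivalence.to T-∧ t in
         λ { zero → head ; (suc i) → Equivalence.to (T-and-tabulate (f ∘ suc)) rest i })
  (λ all → Equivalence.from T-∧ (all zero , Equivalence.from (T-and-tabulate (f ∘ suc)) (all ∘ suc)))

T-and-allFin : ∀ {m} (f : Fin m → Bool) → T (and (List.map f (List.allFin m))) ⇔ (∀ i → T (f i))
T-and-allFin {m} f =
  ≡.subst (λ bs → T (and bs) ⇔ (∀ i → T (f i))) (sym (List.map-tabulate (λ i → i) f)) (T-and-tabulate f)

∈⇔T-lookup : ∀ {m} {x : Fin m} {p : Subset m} → x ∈ p ⇔ T (lookup p x)
∈⇔T-lookup {x = x} {p} = mk⇔ (Equivalence.from T-≡ ∘ []=⇒lookup) (lookup⇒[]= x p ∘ Equivalence.to T-≡)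

T-all-∈ : ∀ {m} (G : Subset m) (f : Fin m → Bool) {Q : Fin m → Set} → (∀ y → T (f y) ⇔ Q y) →
          T (and (List.map (λ y → not (lookup G y) ∨ f y) (List.allFin m))) ⇔ (∀ y → y ∈ G → Q y)
T-all-∈ G f f⇔Q = mk⇔
  (λ t y y∈G → Equivalence.to (f⇔Q y)
     (Equivalence.to T-not-∨ (Equivalence.to (T-and-allFin _) t y) (Equivalence.to ∈⇔T-lookup y∈G)))
  (λ all → Equivalence.from (T-and-allFin _) λ y → Equivalence.from T-not-∨ λ t →
     Equivalence.from (f⇔Q y) (all y (Equivalence.from ∈⇔T-lookup t)))

module _ {m ℓ} {_⊑_ : Rel (Fin m) ℓ} (isPO : IsPartialOrder _≡_ _⊑_) (_⊑?_ : Decidable _⊑_) where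

  minimal : ∀ {q} {Q : Pred (Fin m) q} → (∀ x → Dec (Q x)) → ∀ {w} → Q w →
            ∃[ u ] Q u × (∀ {z} → Q z → z ⊑ u → z ≡ u)
  minimal {Q = Q} Q? {w} Qw = go (po-wellFounded isPO w) Qw
    where
    go : ∀ {w} → Acc (ToStrict._<_ _≡_ _⊑_) w → Q w → ∃[ u ] Q u × (∀ {z} → Q z → z ⊑ u → z ≡ u)
    go {w} (acc below) Qw with any? (λ z → Q? z ×-dec (z ⊑? w) ×-dec ¬? (z ≟ᶠ w))
    ... | yes (z , Qz , z⊑w , z≢w) = go (below (z⊑w , z≢w)) Qz
    ... | no  none = w , Qw , λ {z} Qz z⊑w →
      decidable-stable (z ≟ᶠ w) (λ z≢w → none (z , Qz , z⊑w , z≢w))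

module Graded (P : FinGradedPoset) where
  open FinGradedPoset P

  infix 4 _≺_ _≺?_ _⋖_

  _≺_ : Fin n → Fin n → Set
  _≺_ = Defs._≺_ P

  _≺?_ : Decidable _≺_
  x ≺? y = (x ≼? y) ×-dec ¬? (x ≟ᶠ y)

  ≼-isPartialOrder : IsPartialOrder _≡_ _≼_
  ≼-isPartialOrder = record
    { isPreorder = record
      { isEquivalence = ≡.isEquivalence
      ; reflexive     = λ { refl → ≼-refl _ }
      ; trans         = ≼-trans
      }
    ; antisym = ≼-antisym
    }

  ≺-≼-trans : ∀ {x y z} → x ≺ y → y ≼ z → x ≺ z
  ≺-≼-trans (x≼y , x≢y) y≼z = ≼-trans x≼y y≼z , λ { refl → x≢y (≼-antisym x≼y y≼z) }

  ≺-trans : ∀ {x y z} → x ≺ y → y ≺ z → x ≺ z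
  ≺-trans x≺y y≺z = ≺-≼-trans x≺y (proj₁ y≺z)

  ≼-reflexive : ∀ {a b} → a ≡ b → a ≼ b
  ≼-reflexive refl = ≼-refl _

  ≼⇒≡⊎≺ : ∀ {x y} → x ≼ y → x ≡ y ⊎ x ≺ y
  ≼⇒≡⊎≺ {x} {y} x≼y with x ≟ᶠ y
  ... | yes x≡y = inj₁ x≡y
  ... | no  x≢y = inj₂ (x≼y , x≢y)

  ≺-irrefl : ∀ {x} → ¬ x ≺ x
  ≺-irrefl (_ , x≢x) = x≢x refl

  _⋖_ : Fin n → Fin n → Set
  x ⋖ y = x ≺ y × (∀ {z} → x ≼ z → z ≼ y → z ≡ x ⊎ z ≡ y)

  ρ-⋖ : ∀ {x y} → x ⋖ y → ρ y ≡ suc (ρ x)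
  ρ-⋖ ((x≼y , x≢y) , between) = ρ-cover _ _ x≼y x≢y (λ _ → between)

  ⋖-above : ∀ {x y} → x ≺ y → ∃[ c ] x ⋖ c × c ≼ y
  ⋖-above {x} {y} x≺y with minimal ≼-isPartialOrder _≼?_ (λ z → (x ≺? z) ×-dec (z ≼? y)) (x≺y , ≼-refl y)
  ... | c , (x≺c , c≼y) , least = c , (x≺c , between) , c≼y
    where
    between : ∀ {z} → x ≼ z → z ≼ c → z ≡ x ⊎ z ≡ c
    between {z} x≼z z≼c with z ≟ᶠ x
    ... | yes z≡x = inj₁ z≡x
    ... | no  z≢x = inj₂ (least ((x≼z , z≢x ∘ sym) , ≼-trans z≼c c≼y) z≼c)

  ⋖-below : ∀ {x y} → x ≺ y → ∃[ b ] x ≼ b × b ⋖ y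
  ⋖-below {x} {y} x≺y
    with minimal (Flip.isPartialOrder ≼-isPartialOrder) (flip _≼?_) (λ z → (x ≼? z) ×-dec (z ≺? y)) (≼-refl x , x≺y)
  ... | b , (x≼b , b≺y) , greatest = b , x≼b , (b≺y , between)
    where
    between : ∀ {z} → b ≼ z → z ≼ y → z ≡ b ⊎ z ≡ y
    between {z} b≼z z≼y with z ≟ᶠ y
    ... | yes z≡y = inj₂ z≡y
    ... | no  z≢y = inj₁ (greatest (≼-trans x≼b b≼z , z≼y , z≢y) b≼z)

  ≺-wellFounded : WellFounded _≺_
  ≺-wellFounded = po-wellFounded ≼-isPartialOrder

  ≻-wellFounded : WellFounded (flip _≺_)
  ≻-wellFounded = po-noetherian ≼-isPartialOrder

  ρ-mono : ∀ {x y} → x ≼ y → ρ x ℕ.≤ ρ y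
  ρ-mono {x} {y} = go (≺-wellFounded y)
    where
    go : ∀ {y} → Acc _≺_ y → x ≼ y → ρ x ℕ.≤ ρ y
    go {y} (acc below) x≼y with x ≟ᶠ y
    ... | yes refl = ℕ.≤-refl
    ... | no  x≢y with ⋖-below (x≼y , x≢y)
    ...   | b , x≼b , b⋖y = ℕ.m≤n⇒m≤o+n 1 (go (below (proj₁ b⋖y)) x≼b) ⟨ ℕ.≤-trans ⟩ ℕ.≤-reflexive (sym (ρ-⋖ b⋖y))

  ρ-strict : ∀ {x y} → x ≺ y → ρ x ℕ.< ρ y
  ρ-strict x≺y with ⋖-below x≺y
  ... | b , x≼b , b⋖y = ℕ.s≤s (ρ-mono x≼b) ⟨ ℕ.≤-trans ⟩ ℕ.≤-reflexive (sym (ρ-⋖ b⋖y))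

  len : Fin n → Fin n → ℕ
  len x y = ρ y ℕ.∸ ρ x

  len-trans : ∀ {x y z} → x ≼ y → y ≼ z → len x z ≡ len x y ℕ.+ len y z
  len-trans {x} {y} {z} x≼y y≼z = ℕ.+-cancelˡ-≡ (ρ x) _ _ (begin
    ρ x ℕ.+ len x z               ≡⟨ ℕ.m+[n∸m]≡n (ρ-mono (≼-trans x≼y y≼z)) ⟩
    ρ z                           ≡⟨ sym (ℕ.m+[n∸m]≡n (ρ-mono y≼z)) ⟩
    ρ y ℕ.+ len y z               ≡⟨ cong (ℕ._+ len y z) (sym (ℕ.m+[n∸m]≡n (ρ-mono x≼y))) ⟩
    ρ x ℕ.+ len x y ℕ.+ len y z   ≡⟨ ℕ.+-assoc (ρ x) _ _ ⟩
    ρ x ℕ.+ (len x y ℕ.+ len y z) ∎)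
    where open ≡-Reasoning

  len-pos : ∀ {x y} → x ≺ y → 1 ℕ.≤ len x y
  len-pos x≺y = ℕ.m<n⇒0<n∸m (ρ-strict x≺y)

  len-⋖ : ∀ {x c y} → x ⋖ c → c ≼ y → len x y ≡ suc (len c y)
  len-⋖ {x} {c} {y} x⋖c c≼y = trans (len-trans (proj₁ (proj₁ x⋖c)) c≼y)
    (cong (ℕ._+ len c y) (trans (cong (ℕ._∸ ρ x) (ρ-⋖ x⋖c))
                              (trans (ℕ.+-∸-assoc 1 (ℕ.≤-refl {ρ x})) (cong suc (ℕ.n∸n≡0 (ρ x))))))

  len-subinterval : ∀ {s a b t} → s ≼ a → a ≼ b → b ≼ t → len s t ≡ len s a ℕ.+ (len a b ℕ.+ len b t)
  len-subinterval {s} {a} s≼a a≼b b≼t = trans (len-trans s≼a (≼-trans a≼b b≼t)) (cong (len s a ℕ.+_) (len-trans a≼b b≼t))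

  len-≤ : ∀ {s a b t} → s ≼ a → a ≼ b → b ≼ t → len a b ℕ.≤ len s t
  len-≤ {s} {a} {b} {t} s≼a a≼b b≼t = begin
    len a b                           ≤⟨ ℕ.m≤m+n (len a b) (len b t) ⟩
    len a b ℕ.+ len b t               ≤⟨ ℕ.m≤n+m _ (len s a) ⟩
    len s a ℕ.+ (len a b ℕ.+ len b t) ≡⟨ sym (len-subinterval s≼a a≼b b≼t) ⟩
    len s t                           ∎
    where open ℕ.≤-Reasoning

  len-proper-subinterval : ∀ {s a b t} → s ≼ a → a ≼ b → b ≼ t → ¬ (a ≡ s × b ≡ t) → len a b ℕ.< len s t
  len-proper-subinterval {s} {a} {b} {t} s≼a a≼b b≼t proper with ≼⇒≡⊎≺ s≼a | ≼⇒≡⊎≺ b≼t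
  ... | inj₁ refl | inj₁ refl = ⊥-elim (proper (refl , refl))
  ... | inj₂ s≺a  | _         = begin-strict
    len a b                           <⟨ ℕ.m<n+m (len a b) (len-pos s≺a) ⟩
    len s a ℕ.+ len a b               ≤⟨ ℕ.+-monoʳ-≤ (len s a) (ℕ.m≤m+n (len a b) (len b t)) ⟩
    len s a ℕ.+ (len a b ℕ.+ len b t) ≡⟨ sym (len-subinterval s≼a a≼b b≼t) ⟩
    len s t                           ∎
    where open ℕ.≤-Reasoning
  ... | inj₁ refl | inj₂ b≺t  = begin-strict
    len a b                           <⟨ ℕ.m<m+n (len a b) (len-pos b≺t) ⟩
    len a b ℕ.+ len b t               ≤⟨ ℕ.m≤n+m _ (len s a) ⟩
    len s a ℕ.+ (len a b ℕ.+ len b t) ≡⟨ sym (len-subinterval s≼a a≼b b≼t) ⟩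
    len s t                           ∎
    where open ℕ.≤-Reasoning

  -- The Möbius function

  between? : ∀ x y h → Dec (x ≼ h × h ≺ y)
  between? x y h = (x ≼? h) ×-dec (h ≺? y)

  [_,_⟩ : Fin n → Fin n → Subset n
  [ x , y ⟩ = setOf (between? x y)

  ∈-[,⟩⁺ : ∀ {x y h} → x ≼ h → h ≺ y → h ∈ [ x , y ⟩
  ∈-[,⟩⁺ {x} {y} x≼h h≺y = ∈-setOf⁺ (between? x y) (x≼h , h≺y)

  ∈-[,⟩⁻ : ∀ {x y h} → h ∈ [ x , y ⟩ → x ≼ h × h ≺ y
  ∈-[,⟩⁻ {x} {y} = ∈-setOf⁻ (between? x y)

  ∣[,⟩∣-< : ∀ {s u t} → s ≼ u → u ≺ t → ∣ [ s , u ⟩ ∣ ℕ.< ∣ [ s , t ⟩ ∣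
  ∣[,⟩∣-< s≼u u≺t = p⊂q⇒∣p∣<∣q∣
    ( (λ h∈ → let s≼h , h≺u = ∈-[,⟩⁻ h∈ in ∈-[,⟩⁺ s≼h (≺-≼-trans h≺u (proj₁ u≺t)))
    , _ , ∈-[,⟩⁺ s≼u u≺t , ≺-irrefl ∘ proj₂ ∘ ∈-[,⟩⁻ )

  ∣[,⟩∣-pos : ∀ {s t} → s ≺ t → 1 ℕ.≤ ∣ [ s , t ⟩ ∣
  ∣[,⟩∣-pos {s} s≺t = ∈⇒∣∣-pos (∈-[,⟩⁺ (≼-refl s) s≺t)

  -- The fuel needed to evaluate μ s t is at most the size of [s,t), which every recursive call shrinks.
  mobiusFuel-stable : ∀ f g {s t} → ∣ [ s , t ⟩ ∣ ℕ.≤ f → ∣ [ s , t ⟩ ∣ ℕ.≤ g →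
                      mobiusFuel P f s t ≡ mobiusFuel P g s t
  mobiusFuel-stable f g {s} {t} bf bg with s ≟ᶠ t
  ... | yes _ = refl
  mobiusFuel-stable ℕ.zero  ℕ.zero                _  _  | no _ = refl
  mobiusFuel-stable ℕ.zero  (suc g) {s} {t} bf _  | no s≢t with s ≼? t
  ... | no  _   = refl
  ... | yes s≼t = ⊥-elim (ℕ.<⇒≱ (∣[,⟩∣-pos (s≼t , s≢t)) bf)
  mobiusFuel-stable (suc f) ℕ.zero  {s} {t} _  bg | no s≢t with s ≼? t
  ... | no  _   = refl
  ... | yes s≼t = ⊥-elim (ℕ.<⇒≱ (∣[,⟩∣-pos (s≼t , s≢t)) bg)
  mobiusFuel-stable (suc f) (suc g) {s} {t} bf bg | no s≢t with s ≼? t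
  ... | no  _   = refl
  ... | yes s≼t = cong (-_ ∘ sumℤ) (List.map-cong summand (allFin P))
    where
    summand : ∀ u → (if ≼ᵇ P s u ∧ ≼ᵇ P u t ∧ not (≡ᵇ P u t) then mobiusFuel P f s u else 0ℤ) ≡
                    (if ≼ᵇ P s u ∧ ≼ᵇ P u t ∧ not (≡ᵇ P u t) then mobiusFuel P g s u else 0ℤ)
    summand u with s ≼? u | u ≼? t | u ≟ᶠ t
    ... | yes s≼u | yes u≼t | no u≢t = mobiusFuel-stable f g (shrink bf) (shrink bg)
      where
      shrink : ∀ {k} → ∣ [ s , t ⟩ ∣ ℕ.≤ suc k → ∣ [ s , u ⟩ ∣ ℕ.≤ k
      shrink b = ℕ.≤-pred (ℕ.≤-trans (∣[,⟩∣-< s≼u (u≼t , u≢t)) b)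
    ... | yes _ | yes _ | yes _ = refl
    ... | yes _ | no  _ | _     = refl
    ... | no  _ | _     | _     = refl

  mobiusFuel-refl : ∀ f s → mobiusFuel P f s s ≡ 1ℤ
  mobiusFuel-refl f s with s ≟ᶠ s
  ... | yes _   = refl
  ... | no  s≢s = ⊥-elim (s≢s refl)

  mobiusFuel-suc : ∀ f {s t} → s ≺ t → mobiusFuel P (suc f) s t ≡
    - sumℤ (List.map (λ u → if ≼ᵇ P s u ∧ ≼ᵇ P u t ∧ not (≡ᵇ P u t) then mobiusFuel P f s u else 0ℤ)
                     (allFin P))
  mobiusFuel-suc f {s} {t} (s≼t , s≢t) with s ≟ᶠ t
  ... | yes s≡t = ⊥-elim (s≢t s≡t)
  ... | no  _ with s ≼? t
  ...   | yes _   = refl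
  ...   | no  s⋠t = ⊥-elim (s⋠t s≼t)

  μ-refl : ∀ s → μ P s s ≡ 1ℤ
  μ-refl = mobiusFuel-refl n

  μ≡sgn-refl : ∀ a → μ P a a ≡ sgn (len a a)
  μ≡sgn-refl a = trans (μ-refl a) (cong sgn (sym (ℕ.n∸n≡0 (ρ a))))

  sgn-len-refl : ∀ x (v : ℤ) → sgn (len x x) * v ≡ v
  sgn-len-refl x v = trans (cong (λ k → sgn k * v) (ℕ.n∸n≡0 (ρ x))) (ℤ.*-identityˡ v)

  μ-rec : ∀ {s t} → s ≺ t → μ P s t ≡ - ∑[ u < n ] when (between? s t u) (μ P s u)
  μ-rec {s} {t} s≺t = begin
    μ P s t                       ≡⟨ mobiusFuel-stable n (suc k) (∣p∣≤n [ s , t ⟩) (ℕ.n≤1+n k) ⟩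
    mobiusFuel P (suc k) s t      ≡⟨ mobiusFuel-suc k s≺t ⟩
    - sumℤ (List.map term (allFin P))
      ≡⟨ cong -_ (trans (cong sumℤ (List.map-tabulate (λ u → u) term)) (sumℤ-tabulate term)) ⟩
    - ∑[ u < n ] term u           ≡⟨ cong -_ (sum-cong-≗ summand) ⟩
    - ∑[ u < n ] when (between? s t u) (μ P s u) ∎
    where
    open ≡-Reasoning
    k = ∣ [ s , t ⟩ ∣
    term : Fin n → ℤ
    term u = if ≼ᵇ P s u ∧ ≼ᵇ P u t ∧ not (≡ᵇ P u t) then mobiusFuel P k s u else 0ℤ
    summand : ∀ u → term u ≡ when (between? s t u) (μ P s u)
    summand u with s ≼? u | u ≼? t | u ≟ᶠ t
    ... | yes s≼u | yes u≼t | no u≢t =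
      mobiusFuel-stable k n (ℕ.<⇒≤ (∣[,⟩∣-< s≼u (u≼t , u≢t))) (∣p∣≤n [ s , u ⟩)
    ... | yes _ | yes _ | yes _ = refl
    ... | yes _ | no  _ | _     = refl
    ... | no  _ | _     | _     = refl

  μ-⋖ : ∀ {s t} → s ⋖ t → μ P s t ≡ -1ℤ
  μ-⋖ {s} {t} (s≺t , between) = begin
    μ P s t                                      ≡⟨ μ-rec s≺t ⟩
    - ∑[ u < n ] when (between? s t u) (μ P s u) ≡⟨ cong -_ (∑-unique _ s only-s) ⟩
    - when (between? s t s) (μ P s s)            ≡⟨ cong -_ (when-yes (between? s t s) (≼-refl s , s≺t)) ⟩
    - μ P s s                                    ≡⟨ cong -_ (μ-refl s) ⟩
    -1ℤ                                          ∎
    where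
    open ≡-Reasoning
    only-s : ∀ u → u ≢ s → when (between? s t u) (μ P s u) ≡ 0ℤ
    only-s u u≢s = when-no (between? s t u) λ (s≼u , u≼t , u≢t) →
      [ u≢s , u≢t ]′ (between s≼u u≼t)

  -- Eulerian intervals and chains

  chain-length : ∀ {x C y} → StrictChain P x C y → x ≺ y × suc (length C) ℕ.≤ len x y
  chain-length {C = []}    x≺y         = x≺y , len-pos x≺y
  chain-length {C = c ∷ C} (x≺c , c…y) =
    let c≺y , |C|<len = chain-length c…y in
    ≺-trans x≺c c≺y ,
    ℕ.≤-trans (ℕ.+-mono-≤ (len-pos x≺c) |C|<len) (ℕ.≤-reflexive (sym (len-trans (proj₁ x≺c) (proj₁ c≺y))))

  EulerianUpTo : ℕ → Set
  EulerianUpTo m = ∀ {a b} → a ≺ b → len a b ℕ.≤ m → μ P a b ≡ sgn (len a b)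

  μChain-eulerian : ∀ {m} → EulerianUpTo m →
                    ∀ {x C y} → StrictChain P x C y → len x y ℕ.≤ m ℕ.+ length C →
                    μChain P x C y ≡ sgn (len x y)
  μChain-eulerian eul {C = []}    x≺y         short = eul x≺y (ℕ.≤-trans short (ℕ.≤-reflexive (ℕ.+-identityʳ _)))
  μChain-eulerian {m} eul {x} {c ∷ C} {y} (x≺c , c…y) short = begin
    μ P x c * μChain P c C y      ≡⟨ cong₂ _*_ (eul x≺c first-short) (μChain-eulerian eul c…y rest-short) ⟩
    sgn (len x c) * sgn (len c y) ≡⟨ sym (sgn-+ (len x c) (len c y)) ⟩
    sgn (len x c ℕ.+ len c y)     ≡⟨ cong sgn (sym split) ⟩
    sgn (len x y)                 ∎
    where
    open ≡-Reasoning
    split = len-trans (proj₁ x≺c) (proj₁ (proj₁ (chain-length c…y)))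
    total : len x c ℕ.+ len c y ℕ.≤ m ℕ.+ suc (length C)
    total = ℕ.≤-trans (ℕ.≤-reflexive (sym split)) short
    first-short : len x c ℕ.≤ m
    first-short = ℕ.+-cancelʳ-≤ (suc (length C)) _ _
      (ℕ.≤-trans (ℕ.+-monoʳ-≤ (len x c) (proj₂ (chain-length c…y))) total)
    rest-short : len c y ℕ.≤ m ℕ.+ length C
    rest-short = ℕ.≤-pred (ℕ.≤-trans (ℕ.+-monoˡ-≤ (len c y) (len-pos x≺c))
                                     (ℕ.≤-trans total (ℕ.≤-reflexive (ℕ.+-suc m (length C)))))

  cover-induction : (Q : Fin n → Fin n → Set) → (∀ {x} → Q x x) →
                    (∀ {x c y} → x ⋖ c → c ≼ y → Q c y → Q x y) →
                    ∀ {x y} → x ≼ y → Q x y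
  cover-induction Q base step {x} {y} = go (≻-wellFounded x)
    where
    go : ∀ {x} → Acc (flip _≺_) x → x ≼ y → Q x y
    go {x} (acc above) x≼y with x ≟ᶠ y
    ... | yes refl = base
    ... | no  x≢y with ⋖-above (x≼y , x≢y)
    ...   | c , x⋖c , c≼y = step x⋖c c≼y (go (above (proj₁ x⋖c)) c≼y)

  extendˡ : ∀ {x a} → x ≼ a → ∀ {C y} → StrictChain P a C y →
            ∃[ A ] StrictChain P x (A ++ C) y × length A ≡ len x a ×
                   μChain P x (A ++ C) y ≡ sgn (len x a) * μChain P a C y
  extendˡ = cover-induction Extendable (λ {x} a…y → [] , a…y , sym (ℕ.n∸n≡0 (ρ x)) , sym (sgn-len-refl x _)) step
    where
    Extendable : Fin n → Fin n → Set
    Extendable x a = ∀ {C y} → StrictChain P a C y →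
      ∃[ A ] StrictChain P x (A ++ C) y × length A ≡ len x a ×
             μChain P x (A ++ C) y ≡ sgn (len x a) * μChain P a C y
    step : ∀ {x c a} → x ⋖ c → c ≼ a → Extendable c a → Extendable x a
    step {x} {c} {a} x⋖c c≼a extend {C} {y} a…y with extend a…y
    ... | A , c…y , |A| , μc…y = c ∷ A , (proj₁ x⋖c , c…y) , trans (cong suc |A|) (sym (len-⋖ x⋖c c≼a)) , (begin
      μ P x c * μChain P c (A ++ C) y                 ≡⟨ cong₂ _*_ (μ-⋖ x⋖c) μc…y ⟩
      -1ℤ * (sgn (len c a) * μChain P a C y)          ≡⟨ ℤ.-1*i≡-i _ ⟩
      - (sgn (len c a) * μChain P a C y)              ≡⟨ ℤ.neg-distribˡ-* (sgn (len c a)) _ ⟩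
      sgn (suc (len c a)) * μChain P a C y            ≡⟨ cong (λ k → sgn k * μChain P a C y) (sym (len-⋖ x⋖c c≼a)) ⟩
      sgn (len x a) * μChain P a C y                  ∎)
      where open ≡-Reasoning

  chain-snoc : ∀ {x C b c} → StrictChain P x C b → b ≺ c → StrictChain P x (C ++ b ∷ []) c
  chain-snoc {C = []}    x≺b         b≺c = x≺b , b≺c
  chain-snoc {C = d ∷ C} (x≺d , d…b) b≺c = x≺d , chain-snoc d…b b≺c

  μChain-snoc : ∀ x C b c → μChain P x (C ++ b ∷ []) c ≡ μChain P x C b * μ P b c
  μChain-snoc x []      b c = refl
  μChain-snoc x (d ∷ C) b c = trans (cong (μ P x d *_) (μChain-snoc d C b c)) (sym (ℤ.*-assoc (μ P x d) _ _))

  extendʳ : ∀ {b y} → b ≼ y → ∀ {x C} → StrictChain P x C b →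
            ∃[ B ] StrictChain P x (C ++ B) y × length B ≡ len b y ×
                   μChain P x (C ++ B) y ≡ μChain P x C b * sgn (len b y)
  extendʳ = cover-induction Extendable base step
    where
    Extendable : Fin n → Fin n → Set
    Extendable b y = ∀ {x C} → StrictChain P x C b →
      ∃[ B ] StrictChain P x (C ++ B) y × length B ≡ len b y ×
             μChain P x (C ++ B) y ≡ μChain P x C b * sgn (len b y)
    base : ∀ {b} → Extendable b b
    base {b} {x} {C} x…b = [] , ≡.subst (λ D → StrictChain P x D b) (sym (List.++-identityʳ C)) x…b ,
      sym (ℕ.n∸n≡0 (ρ b)) ,
      trans (cong (λ D → μChain P x D b) (List.++-identityʳ C))
            (sym (trans (ℤ.*-comm _ (sgn (len b b))) (sgn-len-refl b _)))
    step : ∀ {b c y} → b ⋖ c → c ≼ y → Extendable c y → Extendable b y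
    step {b} {c} {y} b⋖c c≼y extend {x} {C} x…b with extend (chain-snoc x…b (proj₁ b⋖c))
    ... | B , x…y , |B| , μx…y = b ∷ B ,
      ≡.subst (λ D → StrictChain P x D y) (List.++-assoc C (b ∷ []) B) x…y ,
      trans (cong suc |B|) (sym (len-⋖ b⋖c c≼y)) , (begin
      μChain P x (C ++ b ∷ B) y                        ≡⟨ cong (λ D → μChain P x D y) (sym (List.++-assoc C (b ∷ []) B)) ⟩
      μChain P x ((C ++ b ∷ []) ++ B) y                ≡⟨ μx…y ⟩
      μChain P x (C ++ b ∷ []) c * sgn (len c y)       ≡⟨ cong (_* sgn (len c y)) (μChain-snoc x C b c) ⟩
      μChain P x C b * μ P b c * sgn (len c y)         ≡⟨ ℤ.*-assoc (μChain P x C b) _ _ ⟩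
      μChain P x C b * (μ P b c * sgn (len c y))       ≡⟨ cong (λ v → μChain P x C b * (v * sgn (len c y))) (μ-⋖ b⋖c) ⟩
      μChain P x C b * (-1ℤ * sgn (len c y))           ≡⟨ cong (μChain P x C b *_) (ℤ.-1*i≡-i _) ⟩
      μChain P x C b * sgn (suc (len c y))             ≡⟨ cong (λ k → μChain P x C b * sgn k) (sym (len-⋖ b⋖c c≼y)) ⟩
      μChain P x C b * sgn (len b y)                   ∎)
      where open ≡-Reasoning

  ChainProducts : ℕ → Set
  ChainProducts t = ∀ {C} → StrictChain P 0̂ C 1̂ → t ℕ.≤ length C → μChain P 0̂ C 1̂ ≡ sgn (len 0̂ 1̂)

  eulerian⇒chainProducts : ∀ t → EulerianUpTo (len 0̂ 1̂ ℕ.∸ t) → ChainProducts t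
  eulerian⇒chainProducts t eul {C} 0̂…1̂ t≤|C| = μChain-eulerian eul 0̂…1̂ (begin
    len 0̂ 1̂                        ≤⟨ ℕ.m≤n+m∸n (len 0̂ 1̂) t ⟩
    t ℕ.+ (len 0̂ 1̂ ℕ.∸ t)          ≤⟨ ℕ.+-monoˡ-≤ _ t≤|C| ⟩
    length C ℕ.+ (len 0̂ 1̂ ℕ.∸ t)   ≡⟨ ℕ.+-comm (length C) _ ⟩
    (len 0̂ 1̂ ℕ.∸ t) ℕ.+ length C   ∎)
    where open ℕ.≤-Reasoning

  -- [a,b] is placed on a chain from 0̂ to 1̂ that is saturated outside [a,b].
  chainProducts⇒eulerian : ∀ t → ChainProducts t → EulerianUpTo (len 0̂ 1̂ ℕ.∸ t)
  chainProducts⇒eulerian t chains {a} {b} (a≼b , a≢b) short with extendʳ (1̂-max b) {C = []} (a≼b , a≢b)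
  ...   | B , a…1̂ , |B| , μa…1̂ with extendˡ (0̂-min a) a…1̂
  ...     | A , 0̂…1̂ , |A| , μ0̂…1̂ = sgn-*-cancelʳ q (sgn-*-cancelˡ p signs)
    where
    p = len 0̂ a
    ℓ = len a b
    q = len b 1̂
    whole : len 0̂ 1̂ ≡ p ℕ.+ (ℓ ℕ.+ q)
    whole = trans (len-trans (0̂-min a) (1̂-max a)) (cong (p ℕ.+_) (len-trans a≼b (1̂-max b)))
    t<len : t ℕ.< len 0̂ 1̂
    t<len = ℕ.m∸n≢0⇒n<m (ℕ.m<n⇒n≢0 (ℕ.≤-trans (len-pos (a≼b , a≢b)) short))
    enough : t ℕ.≤ length (A ++ B)
    enough = ℕ.+-cancelʳ-≤ ℓ t _ (begin
      t ℕ.+ ℓ               ≤⟨ ℕ.+-monoʳ-≤ t short ⟩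
      t ℕ.+ (len 0̂ 1̂ ℕ.∸ t) ≡⟨ ℕ.m+[n∸m]≡n (ℕ.<⇒≤ t<len) ⟩
      len 0̂ 1̂               ≡⟨ whole ⟩
      p ℕ.+ (ℓ ℕ.+ q)       ≡⟨ cong (p ℕ.+_) (ℕ.+-comm ℓ q) ⟩
      p ℕ.+ (q ℕ.+ ℓ)       ≡⟨ ℕ.+-assoc p q ℓ ⟨
      p ℕ.+ q ℕ.+ ℓ         ≡⟨ cong (ℕ._+ ℓ) (trans (List.length-++ A) (cong₂ ℕ._+_ |A| |B|)) ⟨
      length (A ++ B) ℕ.+ ℓ ∎)
      where open ℕ.≤-Reasoning
    signs : sgn p * (μ P a b * sgn q) ≡ sgn p * (sgn ℓ * sgn q)
    signs = begin
      sgn p * (μ P a b * sgn q) ≡⟨ trans (cong (sgn p *_) (sym μa…1̂)) (sym μ0̂…1̂) ⟩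
      μChain P 0̂ (A ++ B) 1̂    ≡⟨ chains 0̂…1̂ enough ⟩
      sgn (len 0̂ 1̂)            ≡⟨ cong sgn whole ⟩
      sgn (p ℕ.+ (ℓ ℕ.+ q))    ≡⟨ trans (sgn-+ p _) (cong (sgn p *_) (sgn-+ ℓ q)) ⟩
      sgn p * (sgn ℓ * sgn q)  ∎
      where open ≡-Reasoning

  eulerian⇔chainProducts : ∀ t → EulerianUpTo (len 0̂ 1̂ ℕ.∸ t) ⇔ ChainProducts t
  eulerian⇔chainProducts t = mk⇔ (eulerian⇒chainProducts t) (chainProducts⇒eulerian t)

  shorter-superinterval : ∀ {s a b t} → s ≼ a → a ≼ b → b ≼ t → len a b ℕ.< len s t →
    ∃[ a′ ] ∃[ b′ ] (s ≼ a′ × a′ ≼ a × b ≼ b′ × b′ ≼ t × suc (len a′ b′) ≡ len s t)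
  shorter-superinterval {s} {a} {b} {t} s≼a a≼b b≼t shorter with ≼⇒≡⊎≺ s≼a | ≼⇒≡⊎≺ b≼t
  ... | inj₂ s≺a  | _         with ⋖-above s≺a
  ...   | a′ , s⋖a′ , a′≼a = a′ , t , proj₁ (proj₁ s⋖a′) , a′≼a , b≼t , ≼-refl t ,
                               sym (len-⋖ s⋖a′ (≼-trans a′≼a (≼-trans a≼b b≼t)))
  shorter-superinterval _ _ _ shorter | inj₁ refl | inj₁ refl = ⊥-elim (ℕ.<-irrefl refl shorter)
  shorter-superinterval {s} {a} {b} {t} _ a≼b b≼t _ | inj₁ refl | inj₂ b≺t with ⋖-below b≺t
  ...   | b′ , b≼b′ , b′⋖t = s , b′ , ≼-refl s , ≼-refl s , b≼b′ , proj₁ (proj₁ b′⋖t) , (begin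
    suc (len s b′)            ≡⟨ ℕ.+-comm 1 (len s b′) ⟩
    len s b′ ℕ.+ 1            ≡⟨ cong (len s b′ ℕ.+_) (sym (trans (len-⋖ b′⋖t (≼-refl t)) (cong suc (ℕ.n∸n≡0 (ρ t))))) ⟩
    len s b′ ℕ.+ len b′ t     ≡⟨ sym (len-trans (≼-trans a≼b b≼b′) (proj₁ (proj₁ b′⋖t))) ⟩
    len s t                   ∎)
    where open ≡-Reasoning

  EulerianCodim : ℕ → Fin n → Fin n → Set
  EulerianCodim c s t = ∀ {a b} → s ≼ a → a ≼ b → b ≼ t → len a b ℕ.+ c ℕ.≤ len s t →
                        μ P a b ≡ sgn (len a b)

  singK⇔eulerianCodim : ∀ k {s t} → SingK P (suc k) s t ⇔ EulerianCodim (suc k) s t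
  singK⇔eulerianCodim ℕ.zero {s} {t} = mk⇔
    (λ semi {a} {b} s≼a a≼b b≼t short → semi a b s≼a a≼b b≼t λ { (refl , refl) →
      ℕ.<-irrefl refl (ℕ.≤-trans (ℕ.≤-reflexive (ℕ.+-comm 1 (len s t))) short) })
    (λ codim a b s≼a a≼b b≼t proper → codim s≼a a≼b b≼t
      (ℕ.≤-trans (ℕ.≤-reflexive (ℕ.+-comm (len a b) 1)) (len-proper-subinterval s≼a a≼b b≼t proper)))
  singK⇔eulerianCodim (suc k) {s} {t} = mk⇔ to from
    where
    to : SingK P (suc (suc k)) s t → EulerianCodim (suc (suc k)) s t
    to sing {c} {e} s≼c c≼e e≼t short
      with shorter-superinterval s≼c c≼e e≼t (ℕ.≤-trans (ℕ.m<m+n _ ℕ.z<s) short)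
    ... | a , b , s≼a , a≼c , e≼b , b≼t , len-a-b =
      Equivalence.to (singK⇔eulerianCodim k)
        (sing a b s≼a (≼-trans a≼c (≼-trans c≼e e≼b)) b≼t (ℕ.≤-reflexive len-a-b)) a≼c c≼e e≼b
        (ℕ.≤-pred (begin
          suc (len c e ℕ.+ suc k) ≡⟨ ℕ.+-suc (len c e) (suc k) ⟨
          len c e ℕ.+ suc (suc k) ≤⟨ short ⟩
          len s t                 ≡⟨ len-a-b ⟨
          suc (len a b)           ∎))
      where open ℕ.≤-Reasoning
    from : EulerianCodim (suc (suc k)) s t → SingK P (suc (suc k)) s t
    from codim a b s≼a a≼b b≼t len< = Equivalence.from (singK⇔eulerianCodim k) λ a≼c c≼e e≼b short →
      codim (≼-trans s≼a a≼c) c≼e (≼-trans e≼b b≼t)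
        (ℕ.≤-trans (ℕ.≤-reflexive (ℕ.+-suc _ (suc k))) (ℕ.≤-trans (ℕ.s≤s short) len<))

  eulerianInt⇔eulerian : EulerianInt P 0̂ 1̂ ⇔ EulerianUpTo (len 0̂ 1̂)
  eulerianInt⇔eulerian = mk⇔
    (λ eul {a} {b} a≺b _ → eul a b (0̂-min a) (proj₁ a≺b) (1̂-max b))
    (λ eul a b _ a≼b _ → [ (λ { refl → μ≡sgn-refl a }) , (λ a≺b → eul a≺b (len-≤ (0̂-min a) a≼b (1̂-max b))) ]′ (≼⇒≡⊎≺ a≼b))

  eulerianCodim⇔eulerian : ∀ c → EulerianCodim c 0̂ 1̂ ⇔ EulerianUpTo (len 0̂ 1̂ ℕ.∸ c)
  eulerianCodim⇔eulerian c = mk⇔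
    (λ codim {a} {b} a≺b short → codim (0̂-min a) (proj₁ a≺b) (1̂-max b)
      (ℕ.m≤o∸n⇒m+n≤o (len a b) (ℕ.<⇒≤ (ℕ.m∸n≢0⇒n<m (ℕ.m<n⇒n≢0 (ℕ.≤-trans (len-pos a≺b) short)))) short))
    (λ eul {a} {b} _ a≼b _ long → [ (λ { refl → μ≡sgn-refl a }) , (λ a≺b → eul a≺b (ℕ.m+n≤o⇒m≤o∸n (len a b) long)) ]′ (≼⇒≡⊎≺ a≼b))

  -- Chains and Philip Hall's theorem

  Comparable : Fin n → Fin n → Set
  Comparable x y = x ≼ y ⊎ y ≼ x

  IsChain : Subset n → Set
  IsChain H = ∀ h h′ → h ∈ H → h′ ∈ H → Comparable h h′

  isChain? : ∀ H → Dec (IsChain H)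
  isChain? H = all? λ h → all? λ h′ → (h ∈? H) →-dec (h′ ∈? H) →-dec ((h ≼? h′) ⊎-dec (h′ ≼? h))

  IsChain-⊆ : ∀ {G H} → G ⊆ H → IsChain H → IsChain G
  IsChain-⊆ G⊆H chain h h′ h∈G h′∈G = chain h h′ (G⊆H h∈G) (G⊆H h′∈G)

  ⁅⁆∪-isChain : ∀ {x H} → (∀ {h} → h ∈ H → Comparable x h) → IsChain H → IsChain (⁅ x ⁆ ∪ H)
  ⁅⁆∪-isChain {x} {H} x~H chain h h′ h∈ h′∈ with ∈-⁅⁆∪⁻ h∈ | ∈-⁅⁆∪⁻ h′∈
  ... | inj₁ refl | inj₁ refl = inj₁ (≼-refl x)
  ... | inj₁ refl | inj₂ h′∈H = x~H h′∈H
  ... | inj₂ h∈H  | inj₁ refl = ⊎.swap (x~H h∈H)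
  ... | inj₂ h∈H  | inj₂ h′∈H = chain h h′ h∈H h′∈H

  ChainThrough : Subset n → Fin n → Fin n → Subset n → Set
  ChainThrough K x y H = K ⊆ H × H ⊆ [ x , y ⟩ × IsChain H

  chainThrough? : ∀ K x y H → Dec (ChainThrough K x y H)
  chainThrough? K x y H = (K ⊆? H) ×-dec (H ⊆? [ x , y ⟩) ×-dec isChain? H

  chainSign : Subset n → Fin n → Fin n → Subset n → ℤ
  chainSign K x y H = when (chainThrough? K x y H) (sgn (∣ H ∣ ℕ.∸ ∣ K ∣))

  -- chainSum ⁅ x ⁆ x y is -χ̃ of the order complex of the open interval (x,y), via H ↦ H ∖ {x}.
  chainSum : Subset n → Fin n → Fin n → ℤ
  chainSum K x y = ∑ₛ n (chainSign K x y)

  ↓_ : Fin n → Subset n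
  ↓ u = setOf (_≼? u)

  chain-maximum : ∀ {H h} → IsChain H → h ∈ H → ∃[ u ] u ∈ H × H ⊆ ↓ u
  chain-maximum {H} chain h∈H
    with minimal (Flip.isPartialOrder ≼-isPartialOrder) (flip _≼?_) (_∈? H) h∈H
  ... | u , u∈H , greatest = u , u∈H , λ {h} h∈H → ∈-setOf⁺ (_≼? u)
    ([ (λ h≼u → h≼u) , (λ u≼h → ≼-reflexive (greatest h∈H u≼h)) ]′ (chain h u h∈H u∈H))

  maximum-unique : ∀ {H u v} → u ∈ H → H ⊆ ↓ u → v ∈ H → H ⊆ ↓ v → u ≡ v
  maximum-unique {u = u} {v} u∈H H⊆↓u v∈H H⊆↓v =
    ≼-antisym (∈-setOf⁻ (_≼? v) (H⊆↓v u∈H)) (∈-setOf⁻ (_≼? u) (H⊆↓u v∈H))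

  chainSign-byMaximum : ∀ x y H → chainSign ⁅ x ⁆ x y H ≡
                        ∑[ u < n ] when (⁅ u ⁆ ⊆? H) (when (H ⊆? ↓ u) (chainSign ⁅ x ⁆ x y H))
  chainSign-byMaximum x y H = [ good-case , bad-case ]′ (toSum (chainThrough? ⁅ x ⁆ x y H))
    where
    w = chainSign ⁅ x ⁆ x y H
    good-case : ChainThrough ⁅ x ⁆ x y H → w ≡ ∑[ u < n ] when (⁅ u ⁆ ⊆? H) (when (H ⊆? ↓ u) w)
    good-case (⁅x⁆⊆H , _ , chain) with chain-maximum chain (⁅x⁆⊆H (x∈⁅x⁆ x))
    ... | m , m∈H , H⊆↓m = sym (begin
      ∑[ u < n ] when (⁅ u ⁆ ⊆? H) (when (H ⊆? ↓ u) w) ≡⟨ ∑-unique _ m others ⟩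
      when (⁅ m ⁆ ⊆? H) (when (H ⊆? ↓ m) w)            ≡⟨ when-yes (⁅ m ⁆ ⊆? H) (⁅⁆⊆ m∈H) ⟩
      when (H ⊆? ↓ m) w                                ≡⟨ when-yes (H ⊆? ↓ m) H⊆↓m ⟩
      w                                                ∎)
      where
      open ≡-Reasoning
      others : ∀ v → v ≢ m → when (⁅ v ⁆ ⊆? H) (when (H ⊆? ↓ v) w) ≡ 0ℤ
      others v v≢m = trans (when-when (⁅ v ⁆ ⊆? H) (H ⊆? ↓ v))
        (when-no ((⁅ v ⁆ ⊆? H) ×-dec (H ⊆? ↓ v)) λ (⁅v⁆⊆H , H⊆↓v) →
          v≢m (maximum-unique (⁅v⁆⊆H (x∈⁅x⁆ v)) H⊆↓v m∈H H⊆↓m))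
    bad-case : ¬ ChainThrough ⁅ x ⁆ x y H → w ≡ ∑[ u < n ] when (⁅ u ⁆ ⊆? H) (when (H ⊆? ↓ u) w)
    bad-case bad = begin
      w             ≡⟨ w≡0 ⟩
      0ℤ            ≡⟨ sum-replicate-zero n ⟨
      ∑[ u < n ] 0ℤ ≡⟨ sum-cong-≗ (λ u → trans (cong (λ v → when (⁅ u ⁆ ⊆? H) (when (H ⊆? ↓ u) v)) w≡0)
                                       (trans (cong (when (⁅ u ⁆ ⊆? H)) (when-0 (H ⊆? ↓ u))) (when-0 (⁅ u ⁆ ⊆? H)))) ⟨
      ∑[ u < n ] when (⁅ u ⁆ ⊆? H) (when (H ⊆? ↓ u) w) ∎
      where
      open ≡-Reasoning
      w≡0 = when-no (chainThrough? ⁅ x ⁆ x y H) bad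

  toppedSign : Fin n → Fin n → Fin n → Subset n → ℤ
  toppedSign x y u G = when ((G ⊆? ∁ ⁅ u ⁆) ×-dec ((⁅ u ⁆ ∪ G) ⊆? ↓ u) ×-dec chainThrough? ⁅ x ⁆ x y (⁅ u ⁆ ∪ G))
                        (sgn (∣ ⁅ u ⁆ ∪ G ∣ ℕ.∸ ∣ ⁅ x ⁆ ∣))

  ∑ₛ-withMaximum : ∀ x y u → ∑ₛ n (λ H → when (⁅ u ⁆ ⊆? H) (when (H ⊆? ↓ u) (chainSign ⁅ x ⁆ x y H))) ≡
                             ∑ₛ n (toppedSign x y u)
  ∑ₛ-withMaximum x y u = begin
    ∑ₛ n (λ H → when (⁅ u ⁆ ⊆? H) (when (H ⊆? ↓ u) (chainSign ⁅ x ⁆ x y H)))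
      ≡⟨ ∑ₛ-cong n (λ H → cong (when (⁅ u ⁆ ⊆? H)) (when-when (H ⊆? ↓ u) (chainThrough? ⁅ x ⁆ x y H))) ⟩
    ∑ₛ n (λ H → when (⁅ u ⁆ ⊆? H) (g H))
      ≡⟨ ∑ₛ-∪ n ⁅ u ⁆ g ⟨
    ∑ₛ n (λ G → when (G ⊆? ∁ ⁅ u ⁆) (g (⁅ u ⁆ ∪ G)))
      ≡⟨ ∑ₛ-cong n (λ G → when-when (G ⊆? ∁ ⁅ u ⁆) ((⁅ u ⁆ ∪ G ⊆? ↓ u) ×-dec chainThrough? ⁅ x ⁆ x y (⁅ u ⁆ ∪ G))) ⟩
    ∑ₛ n (toppedSign x y u) ∎
    where
    open ≡-Reasoning
    g : Subset n → ℤ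
    g H = when ((H ⊆? ↓ u) ×-dec chainThrough? ⁅ x ⁆ x y H) (sgn (∣ H ∣ ℕ.∸ ∣ ⁅ x ⁆ ∣))

  ⁅⁆-chainThrough : ∀ {x y} → x ≺ y → ChainThrough ⁅ x ⁆ x y ⁅ x ⁆
  ⁅⁆-chainThrough {x} x≺y = ⊆-refl ,
    (λ {h} h∈⁅x⁆ → ≡.subst (_∈ [ x , _ ⟩) (sym (x∈⁅y⁆⇒x≡y x h∈⁅x⁆)) (∈-[,⟩⁺ (≼-refl x) x≺y)) ,
    λ h h′ h∈ h′∈ → inj₁ (≼-reflexive (trans (x∈⁅y⁆⇒x≡y x h∈) (sym (x∈⁅y⁆⇒x≡y x h′∈))))

  ∑ₛ-toppedSign-self : ∀ {x y} → x ≺ y → ∑ₛ n (toppedSign x y x) ≡ 1ℤ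
  ∑ₛ-toppedSign-self {x} {y} x≺y = trans (∑ₛ-⊥ n only-⊥) (begin
    toppedSign x y x Subset.⊥    ≡⟨ cong F (∪-identityʳ ⁅ x ⁆) ⟩
    F ⁅ x ⁆                      ≡⟨ when-yes ((Subset.⊥ ⊆? ∁ ⁅ x ⁆) ×-dec (⁅ x ⁆ ⊆? ↓ x) ×-dec chainThrough? ⁅ x ⁆ x y ⁅ x ⁆)
                                      (⊥⊆ , ∈-setOf⁺ (_≼? x) ∘ ≼-reflexive ∘ x∈⁅y⁆⇒x≡y x , ⁅⁆-chainThrough x≺y) ⟩
    sgn (∣ ⁅ x ⁆ ∣ ℕ.∸ ∣ ⁅ x ⁆ ∣) ≡⟨ cong sgn (ℕ.n∸n≡0 ∣ ⁅ x ⁆ ∣) ⟩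
    1ℤ                           ∎)
    where
    open ≡-Reasoning
    F : Subset n → ℤ
    F H = when ((Subset.⊥ ⊆? ∁ ⁅ x ⁆) ×-dec (H ⊆? ↓ x) ×-dec chainThrough? ⁅ x ⁆ x y H) (sgn (∣ H ∣ ℕ.∸ ∣ ⁅ x ⁆ ∣))
    only-⊥ : ∀ G → G ≢ Subset.⊥ → toppedSign x y x G ≡ 0ℤ
    only-⊥ G G≢⊥ with ≢⊥⇒nonempty G≢⊥
    ... | h , h∈G = when-no ((G ⊆? ∁ ⁅ x ⁆) ×-dec (⁅ x ⁆ ∪ G ⊆? ↓ x) ×-dec chainThrough? ⁅ x ⁆ x y (⁅ x ⁆ ∪ G))
                      λ (G⊆∁⁅x⁆ , ⊆↓x , _ , ⊆[x,y⟩ , _) →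
      let h∈ = x∈p∪q⁺ (inj₂ h∈G)
          h≡x = ≼-antisym (∈-setOf⁻ (_≼? x) (⊆↓x h∈)) (proj₁ (∈-[,⟩⁻ (⊆[x,y⟩ h∈)))
      in x∈∁p⇒x∉p (G⊆∁⁅x⁆ h∈G) (≡.subst (_∈ ⁅ x ⁆) (sym h≡x) (x∈⁅x⁆ x))

  module Topped {x y u : Fin n} (u≢x : u ≢ x) (G : Subset n) where

    ToppedChain : Set
    ToppedChain = G ⊆ ∁ ⁅ u ⁆ × ⁅ u ⁆ ∪ G ⊆ ↓ u × ChainThrough ⁅ x ⁆ x y (⁅ u ⁆ ∪ G)

    x∈G : ⁅ x ⁆ ⊆ ⁅ u ⁆ ∪ G → x ∈ G
    x∈G ⁅x⁆⊆ = [ (λ x≡u → ⊥-elim (u≢x (sym x≡u))) , (λ x∈G → x∈G) ]′ (∈-⁅⁆∪⁻ (⁅x⁆⊆ (x∈⁅x⁆ x)))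

    topped⇒below : ToppedChain → (x ≼ u × u ≺ y) × ChainThrough ⁅ x ⁆ x u G
    topped⇒below (G⊆∁⁅u⁆ , ⊆↓u , ⁅x⁆⊆ , ⊆[x,y⟩ , chain) =
      ∈-[,⟩⁻ (⊆[x,y⟩ (x∈p∪q⁺ (inj₁ (x∈⁅x⁆ u)))) , ⁅⁆⊆ (x∈G ⁅x⁆⊆) ,
      (λ h∈G → ∈-[,⟩⁺ (proj₁ (∈-[,⟩⁻ (⊆[x,y⟩ (G⊆ h∈G))))
                      (∈-setOf⁻ (_≼? u) (⊆↓u (G⊆ h∈G)) , x∉⁅y⁆⇒x≢y (x∈∁p⇒x∉p (G⊆∁⁅u⁆ h∈G)))) ,
      IsChain-⊆ G⊆ chain
      where
      G⊆ : G ⊆ ⁅ u ⁆ ∪ G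
      G⊆ = q⊆p∪q ⁅ u ⁆ G

    below⇒topped : (x ≼ u × u ≺ y) × ChainThrough ⁅ x ⁆ x u G → ToppedChain
    below⇒topped ((x≼u , u≺y) , ⁅x⁆⊆G , G⊆[x,u⟩ , chain) =
      (λ {h} h∈G → x∉p⇒x∈∁p λ h∈⁅u⁆ → ≺-irrefl (≡.subst (h ≺_) (sym (x∈⁅y⁆⇒x≡y u h∈⁅u⁆)) (below h∈G))) ,
      (λ h∈ → ∈-setOf⁺ (_≼? u) ([ (λ { refl → ≼-refl u }) , proj₁ ∘ below ]′ (∈-⁅⁆∪⁻ h∈))) ,
      q⊆p∪q ⁅ u ⁆ G ∘ ⁅x⁆⊆G ,
      (λ h∈ → [ (λ { refl → ∈-[,⟩⁺ x≼u u≺y })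
              , (λ h∈G → ∈-[,⟩⁺ (proj₁ (∈-[,⟩⁻ (G⊆[x,u⟩ h∈G))) (≺-trans (below h∈G) u≺y)) ]′ (∈-⁅⁆∪⁻ h∈)) ,
      ⁅⁆∪-isChain (inj₂ ∘ proj₁ ∘ below) chain
      where
      below : ∀ {h} → h ∈ G → h ≺ u
      below = proj₂ ∘ ∈-[,⟩⁻ ∘ G⊆[x,u⟩

    sgn-topped : ToppedChain → sgn (∣ ⁅ u ⁆ ∪ G ∣ ℕ.∸ ∣ ⁅ x ⁆ ∣) ≡ - sgn (∣ G ∣ ℕ.∸ ∣ ⁅ x ⁆ ∣)
    sgn-topped (G⊆∁⁅u⁆ , _ , ⁅x⁆⊆ , _) = begin
      sgn (∣ ⁅ u ⁆ ∪ G ∣ ℕ.∸ ∣ ⁅ x ⁆ ∣) ≡⟨ cong₂ (λ a b → sgn (a ℕ.∸ b)) ∣⁅u⁆∪G∣ (∣⁅x⁆∣≡1 x) ⟩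
      sgn (suc ∣ G ∣ ℕ.∸ 1)             ≡⟨ sgn-pred (∈⇒∣∣-pos (x∈G ⁅x⁆⊆)) ⟩
      - sgn (∣ G ∣ ℕ.∸ 1)               ≡⟨ cong (λ b → - sgn (∣ G ∣ ℕ.∸ b)) (∣⁅x⁆∣≡1 x) ⟨
      - sgn (∣ G ∣ ℕ.∸ ∣ ⁅ x ⁆ ∣)       ∎
      where
      open ≡-Reasoning
      ∣⁅u⁆∪G∣ : ∣ ⁅ u ⁆ ∪ G ∣ ≡ suc ∣ G ∣
      ∣⁅u⁆∪G∣ = trans (∣∪∣-disjoint ⁅ u ⁆ G λ h∈⁅u⁆ → x∉p⇒x∈∁p λ h∈G → x∈∁p⇒x∉p (G⊆∁⁅u⁆ h∈G) h∈⁅u⁆)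
                      (cong (ℕ._+ ∣ G ∣) (∣⁅x⁆∣≡1 u))

    toppedSign≡ : toppedSign x y u G ≡ when (between? x y u) (- chainSign ⁅ x ⁆ x u G)
    toppedSign≡ = begin
      toppedSign x y u G
        ≡⟨ when-cong ((G ⊆? ∁ ⁅ u ⁆) ×-dec (⁅ u ⁆ ∪ G ⊆? ↓ u) ×-dec chainThrough? ⁅ x ⁆ x y (⁅ u ⁆ ∪ G))
                     (between? x y u ×-dec chainThrough? ⁅ x ⁆ x u G) topped⇒below below⇒topped sgn-topped ⟩
      when (between? x y u ×-dec chainThrough? ⁅ x ⁆ x u G) (- sgn (∣ G ∣ ℕ.∸ ∣ ⁅ x ⁆ ∣))
        ≡⟨ when-when (between? x y u) (chainThrough? ⁅ x ⁆ x u G) ⟨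
      when (between? x y u) (when (chainThrough? ⁅ x ⁆ x u G) (- sgn (∣ G ∣ ℕ.∸ ∣ ⁅ x ⁆ ∣)))
        ≡⟨ cong (when (between? x y u)) (neg-when (chainThrough? ⁅ x ⁆ x u G)) ⟨
      when (between? x y u) (- chainSign ⁅ x ⁆ x u G) ∎
      where open ≡-Reasoning

  -- Philip Hall's theorem.  The chains are grouped by their largest element u; for u ≠ x they are
  -- the chains of [x,u) through x with u added on top.
  hall : ∀ {x y} → x ≺ y → chainSum ⁅ x ⁆ x y ≡ - μ P x y
  hall {x} {y} = go (≺-wellFounded y)
    where
    go : ∀ {y} → Acc _≺_ y → x ≺ y → chainSum ⁅ x ⁆ x y ≡ - μ P x y
    go {y} (acc smaller) x≺y = begin
      chainSum ⁅ x ⁆ x y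
        ≡⟨ ∑ₛ-cong n (chainSign-byMaximum x y) ⟩
      ∑ₛ n (λ H → ∑[ u < n ] when (⁅ u ⁆ ⊆? H) (when (H ⊆? ↓ u) (chainSign ⁅ x ⁆ x y H)))
        ≡⟨ ∑ₛ-∑-comm n n (λ u H → when (⁅ u ⁆ ⊆? H) (when (H ⊆? ↓ u) (chainSign ⁅ x ⁆ x y H))) ⟩
      ∑[ u < n ] ∑ₛ n (λ H → when (⁅ u ⁆ ⊆? H) (when (H ⊆? ↓ u) (chainSign ⁅ x ⁆ x y H)))
        ≡⟨ sum-cong-≗ (λ u → trans (∑ₛ-withMaximum x y u) (topped-sum u)) ⟩
      ∑[ u < n ] when (between? x y u) (μ P x u)
        ≡⟨ ℤ.neg-involutive _ ⟨
      - - ∑[ u < n ] when (between? x y u) (μ P x u)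
        ≡⟨ cong -_ (μ-rec x≺y) ⟨
      - μ P x y ∎
      where
      open ≡-Reasoning
      topped-sum : ∀ u → ∑ₛ n (toppedSign x y u) ≡ when (between? x y u) (μ P x u)
      topped-sum u with u ≟ᶠ x
      ... | yes refl = trans (∑ₛ-toppedSign-self x≺y)
                             (sym (trans (when-yes (between? x y x) (≼-refl x , x≺y)) (μ-refl x)))
      ... | no  u≢x = begin
        ∑ₛ n (toppedSign x y u)
          ≡⟨ ∑ₛ-cong n (λ G → Topped.toppedSign≡ u≢x G) ⟩
        ∑ₛ n (λ G → when (between? x y u) (- chainSign ⁅ x ⁆ x u G))
          ≡⟨ ∑ₛ-when n (between? x y u) (-_ ∘ chainSign ⁅ x ⁆ x u) ⟩
        when (between? x y u) (∑ₛ n (-_ ∘ chainSign ⁅ x ⁆ x u))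
          ≡⟨ cong (when (between? x y u)) (neg-∑ₛ n (chainSign ⁅ x ⁆ x u)) ⟨
        when (between? x y u) (- chainSum ⁅ x ⁆ x u)
          ≡⟨ when-cong (between? x y u) (between? x y u) (λ b → b) (λ b → b) (λ (x≼u , u≺y) →
               trans (cong -_ (go (smaller u≺y) (x≼u , u≢x ∘ sym))) (ℤ.neg-involutive _)) ⟩
        when (between? x y u) (μ P x u) ∎

  module Splitting {x c y : Fin n} {K : Subset n} (x≺c : x ≺ c) (c∈K : c ∈ K) (K⊆[c,y⟩ : K ⊆ [ c , y ⟩) where

    c≺y : c ≺ y
    c≺y = proj₂ (∈-[,⟩⁻ (K⊆[c,y⟩ c∈K))

    lower⊆∁upper : [ x , c ⟩ ⊆ ∁ [ c , y ⟩
    lower⊆∁upper h∈ = x∉p⇒x∈∁p λ h∈′ → ≺-irrefl (≺-≼-trans (proj₂ (∈-[,⟩⁻ h∈)) (proj₁ (∈-[,⟩⁻ h∈′)))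

    SplitsAt : Subset n → Set
    SplitsAt H = H ⊆ [ x , c ⟩ ∪ [ c , y ⟩ × ChainThrough ⁅ x ⁆ x c (H ∩ [ x , c ⟩) × ChainThrough K c y (H ∩ [ c , y ⟩)

    chainThrough⇒splitsAt : ∀ {H} → ChainThrough (⁅ x ⁆ ∪ K) x y H → SplitsAt H
    chainThrough⇒splitsAt {H} (⊆H , H⊆[x,y⟩ , chain) =
      (λ h∈H → x∈p∪q⁺ (side h∈H (chain _ c h∈H (⊆H (x∈p∪q⁺ (inj₂ c∈K)))))) ,
      ( (λ {h} h∈⁅x⁆ → x∈p∩q⁺ (⊆H (x∈p∪q⁺ (inj₁ h∈⁅x⁆)) ,
                                ≡.subst (_∈ [ x , c ⟩) (sym (x∈⁅y⁆⇒x≡y x h∈⁅x⁆)) (∈-[,⟩⁺ (≼-refl x) x≺c)))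
      , proj₂ ∘ x∈p∩q⁻ H _ , IsChain-⊆ (proj₁ ∘ x∈p∩q⁻ H _) chain ) ,
      ( (λ h∈K → x∈p∩q⁺ (⊆H (x∈p∪q⁺ (inj₂ h∈K)) , K⊆[c,y⟩ h∈K))
      , proj₂ ∘ x∈p∩q⁻ H _ , IsChain-⊆ (proj₁ ∘ x∈p∩q⁻ H _) chain )
      where
      side : ∀ {h} → h ∈ H → Comparable h c → h ∈ [ x , c ⟩ ⊎ h ∈ [ c , y ⟩
      side h∈H (inj₂ c≼h) = inj₂ (∈-[,⟩⁺ c≼h (proj₂ (∈-[,⟩⁻ (H⊆[x,y⟩ h∈H))))
      side h∈H (inj₁ h≼c) with ≼⇒≡⊎≺ h≼c
      ... | inj₁ refl = inj₂ (∈-[,⟩⁺ (≼-refl c) c≺y)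
      ... | inj₂ h≺c  = inj₁ (∈-[,⟩⁺ (proj₁ (∈-[,⟩⁻ (H⊆[x,y⟩ h∈H))) h≺c)

    splitsAt⇒chainThrough : ∀ {H} → SplitsAt H → ChainThrough (⁅ x ⁆ ∪ K) x y H
    splitsAt⇒chainThrough {H} (H⊆ , (⁅x⁆⊆ , _ , chain₁) , (K⊆ , _ , chain₂)) =
      (λ h∈ → [ proj₁ ∘ x∈p∩q⁻ H _ ∘ ⁅x⁆⊆ , proj₁ ∘ x∈p∩q⁻ H _ ∘ K⊆ ]′ (x∈p∪q⁻ ⁅ x ⁆ K h∈)) ,
      (λ h∈H → [ (λ h∈ → let x≼h , h≺c = ∈-[,⟩⁻ h∈ in ∈-[,⟩⁺ x≼h (≺-trans h≺c c≺y))
               , (λ h∈ → let c≼h , h≺y = ∈-[,⟩⁻ h∈ in ∈-[,⟩⁺ (≼-trans (proj₁ x≺c) c≼h) h≺y) ]′ (part h∈H)) ,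
      λ h h′ h∈H h′∈H → compare h∈H h′∈H (part h∈H) (part h′∈H)
      where
      part : ∀ {h} → h ∈ H → h ∈ [ x , c ⟩ ⊎ h ∈ [ c , y ⟩
      part h∈H = x∈p∪q⁻ [ x , c ⟩ [ c , y ⟩ (H⊆ h∈H)
      compare : ∀ {h h′} → h ∈ H → h′ ∈ H → h ∈ [ x , c ⟩ ⊎ h ∈ [ c , y ⟩ → h′ ∈ [ x , c ⟩ ⊎ h′ ∈ [ c , y ⟩ →
                Comparable h h′
      compare h∈H h′∈H (inj₁ h∈) (inj₁ h′∈) = chain₁ _ _ (x∈p∩q⁺ (h∈H , h∈)) (x∈p∩q⁺ (h′∈H , h′∈))
      compare h∈H h′∈H (inj₂ h∈) (inj₂ h′∈) = chain₂ _ _ (x∈p∩q⁺ (h∈H , h∈)) (x∈p∩q⁺ (h′∈H , h′∈))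
      compare _ _ (inj₁ h∈) (inj₂ h′∈) = inj₁ (≼-trans (proj₁ (proj₂ (∈-[,⟩⁻ h∈))) (proj₁ (∈-[,⟩⁻ h′∈)))
      compare _ _ (inj₂ h∈) (inj₁ h′∈) = inj₂ (≼-trans (proj₁ (proj₂ (∈-[,⟩⁻ h′∈))) (proj₁ (∈-[,⟩⁻ h∈)))

    ∣∣-splitsAt : ∀ {H} → SplitsAt H →
                  ∣ H ∣ ℕ.∸ ∣ ⁅ x ⁆ ∪ K ∣ ≡ (∣ H ∩ [ x , c ⟩ ∣ ℕ.∸ ∣ ⁅ x ⁆ ∣) ℕ.+ (∣ H ∩ [ c , y ⟩ ∣ ℕ.∸ ∣ K ∣)
    ∣∣-splitsAt {H} (H⊆ , (⁅x⁆⊆ , _) , (K⊆ , _)) = begin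
      ∣ H ∣ ℕ.∸ ∣ ⁅ x ⁆ ∪ K ∣
        ≡⟨ cong₂ ℕ._∸_ (∣∩∣-split H [ x , c ⟩ [ c , y ⟩ H⊆ lower⊆∁upper)
                       (trans (∣∪∣-disjoint ⁅ x ⁆ K x∉K) (cong (ℕ._+ ∣ K ∣) (∣⁅x⁆∣≡1 x))) ⟩
      (∣ H ∩ [ x , c ⟩ ∣ ℕ.+ ∣ H ∩ [ c , y ⟩ ∣) ℕ.∸ suc ∣ K ∣
        ≡⟨ ∸-split _ _ _ (∈⇒∣∣-pos (⁅x⁆⊆ (x∈⁅x⁆ x))) (p⊆q⇒∣p∣≤∣q∣ K⊆) ⟩
      (∣ H ∩ [ x , c ⟩ ∣ ℕ.∸ 1) ℕ.+ (∣ H ∩ [ c , y ⟩ ∣ ℕ.∸ ∣ K ∣)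
        ≡⟨ cong (λ k → (∣ H ∩ [ x , c ⟩ ∣ ℕ.∸ k) ℕ.+ (∣ H ∩ [ c , y ⟩ ∣ ℕ.∸ ∣ K ∣)) (∣⁅x⁆∣≡1 x) ⟨
      (∣ H ∩ [ x , c ⟩ ∣ ℕ.∸ ∣ ⁅ x ⁆ ∣) ℕ.+ (∣ H ∩ [ c , y ⟩ ∣ ℕ.∸ ∣ K ∣) ∎
      where
      open ≡-Reasoning
      x∉K : ⁅ x ⁆ ⊆ ∁ K
      x∉K h∈⁅x⁆ = x∉p⇒x∈∁p λ h∈K → ≺-irrefl (≺-≼-trans (≡.subst (_≺ c) (sym (x∈⁅y⁆⇒x≡y x h∈⁅x⁆)) x≺c)
                                                      (proj₁ (∈-[,⟩⁻ (K⊆[c,y⟩ h∈K))))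

    chainSign-split : ∀ H → chainSign (⁅ x ⁆ ∪ K) x y H ≡
      when (H ⊆? [ x , c ⟩ ∪ [ c , y ⟩) (chainSign ⁅ x ⁆ x c (H ∩ [ x , c ⟩) * chainSign K c y (H ∩ [ c , y ⟩))
    chainSign-split H = begin
      chainSign (⁅ x ⁆ ∪ K) x y H
        ≡⟨ when-cong (chainThrough? (⁅ x ⁆ ∪ K) x y H) (H⊆? ×-dec lower? ×-dec upper?) chainThrough⇒splitsAt splitsAt⇒chainThrough
             (λ through → trans (cong sgn (∣∣-splitsAt (chainThrough⇒splitsAt through)))
                             (sgn-+ (∣ H ∩ [ x , c ⟩ ∣ ℕ.∸ ∣ ⁅ x ⁆ ∣) (∣ H ∩ [ c , y ⟩ ∣ ℕ.∸ ∣ K ∣))) ⟩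
      when (H⊆? ×-dec lower? ×-dec upper?) _ ≡⟨ when-when H⊆? (lower? ×-dec upper?) ⟨
      when H⊆? (when (lower? ×-dec upper?) _) ≡⟨ cong (when H⊆?) (when-* lower? upper?) ⟨
      when H⊆? (chainSign ⁅ x ⁆ x c (H ∩ [ x , c ⟩) * chainSign K c y (H ∩ [ c , y ⟩)) ∎
      where
      open ≡-Reasoning
      H⊆? = H ⊆? [ x , c ⟩ ∪ [ c , y ⟩
      lower? = chainThrough? ⁅ x ⁆ x c (H ∩ [ x , c ⟩)
      upper? = chainThrough? K c y (H ∩ [ c , y ⟩)

    chainSum-⁅⁆∪ : chainSum (⁅ x ⁆ ∪ K) x y ≡ chainSum ⁅ x ⁆ x c * chainSum K c y
    chainSum-⁅⁆∪ = begin
      chainSum (⁅ x ⁆ ∪ K) x y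
        ≡⟨ ∑ₛ-cong n chainSign-split ⟩
      ∑ₛ n (λ H → when (H ⊆? [ x , c ⟩ ∪ [ c , y ⟩) (chainSign ⁅ x ⁆ x c (H ∩ [ x , c ⟩) * chainSign K c y (H ∩ [ c , y ⟩)))
        ≡⟨ ∑ₛ-∩-* n [ x , c ⟩ [ c , y ⟩ lower⊆∁upper (chainSign ⁅ x ⁆ x c) (chainSign K c y) ⟩
      ∑ₛ n (λ H → when (H ⊆? [ x , c ⟩) (chainSign ⁅ x ⁆ x c H)) * ∑ₛ n (λ H → when (H ⊆? [ c , y ⟩) (chainSign K c y H))
        ≡⟨ cong₂ _*_ (∑ₛ-cong n (λ H → when-implied (chainThrough? ⁅ x ⁆ x c H) (H ⊆? [ x , c ⟩) (proj₁ ∘ proj₂)))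
                     (∑ₛ-cong n (λ H → when-implied (chainThrough? K c y H) (H ⊆? [ c , y ⟩) (proj₁ ∘ proj₂))) ⟩
      chainSum ⁅ x ⁆ x c * chainSum K c y ∎
      where open ≡-Reasoning

  chain-bounds : ∀ {x C y h} → StrictChain P x C y → h ∈ fromList C → x ≺ h × h ≺ y
  chain-bounds {C = []}    _           h∈ = ⊥-elim (∉⊥ h∈)
  chain-bounds {C = c ∷ C} (x≺c , c…y) h∈ with ∈-⁅⁆∪⁻ h∈
  ... | inj₁ refl = x≺c , proj₁ (chain-length c…y)
  ... | inj₂ h∈C  = let c≺h , h≺y = chain-bounds c…y h∈C in ≺-trans x≺c c≺h , h≺y

  chain-isChain : ∀ {x C y} → StrictChain P x C y → IsChain (fromList (x ∷ C))
  chain-isChain {C = []}    _           = ⁅⁆∪-isChain (⊥-elim ∘ ∉⊥) (λ _ _ h∈ → ⊥-elim (∉⊥ h∈))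
  chain-isChain {x} {c ∷ C} {y} x…y@(_ , c…y) =
    ⁅⁆∪-isChain (λ h∈ → inj₁ (proj₁ (proj₁ (chain-bounds {x} {c ∷ C} {y} x…y h∈)))) (chain-isChain c…y)

  fromList-chainThrough : ∀ {x C y} → StrictChain P x C y → ChainThrough (fromList (x ∷ C)) x y (fromList (x ∷ C))
  fromList-chainThrough {x} {C} {y} x…y = ⊆-refl , bounded , chain-isChain x…y
    where
    bounded : fromList (x ∷ C) ⊆ [ x , y ⟩
    bounded h∈ = [ (λ { refl → ∈-[,⟩⁺ (≼-refl x) (proj₁ (chain-length x…y)) })
                 , (λ h∈C → let x≺h , h≺y = chain-bounds x…y h∈C in ∈-[,⟩⁺ (proj₁ x≺h) h≺y) ]′ (∈-⁅⁆∪⁻ h∈)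

  chainSum-fromList : ∀ {x C y} → StrictChain P x C y →
                      chainSum (fromList (x ∷ C)) x y ≡ sgn (suc (length C)) * μChain P x C y
  chainSum-fromList {x} {[]} {y} x≺y = begin
    chainSum (⁅ x ⁆ ∪ Subset.⊥) x y ≡⟨ cong (λ K → chainSum K x y) (∪-identityʳ ⁅ x ⁆) ⟩
    chainSum ⁅ x ⁆ x y              ≡⟨ hall x≺y ⟩
    - μ P x y                       ≡⟨ ℤ.-1*i≡-i (μ P x y) ⟨
    -1ℤ * μ P x y                   ∎
    where open ≡-Reasoning
  chainSum-fromList {x} {c ∷ C} {y} (x≺c , c…y) = begin
    chainSum (⁅ x ⁆ ∪ fromList (c ∷ C)) x y
      ≡⟨ Splitting.chainSum-⁅⁆∪ x≺c (x∈p∪q⁺ (inj₁ (x∈⁅x⁆ c))) (proj₁ (proj₂ (fromList-chainThrough c…y))) ⟩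
    chainSum ⁅ x ⁆ x c * chainSum (fromList (c ∷ C)) c y
      ≡⟨ cong₂ _*_ (hall x≺c) (chainSum-fromList c…y) ⟩
    - μ P x c * (sgn (suc (length C)) * μChain P c C y)
      ≡⟨ swap-signs (μ P x c) (sgn (suc (length C))) (μChain P c C y) ⟩
    - sgn (suc (length C)) * (μ P x c * μChain P c C y) ∎
    where
    open ≡-Reasoning
    swap-signs : ∀ a s b → - a * (s * b) ≡ - s * (a * b)
    swap-signs = solve 3 (λ a s b → (:- a) :* (s :* b) := (:- s) :* (a :* b)) refl
      where open +-*-Solver

  -- Faces and links of the reduced order complex

  Face : Subset n → Set
  Face G = (∀ {h} → h ∈ G → 0̂ ≺ h × h ≺ 1̂) × IsChain G

  T-≢ : ∀ {x y} → T (not (≡ᵇ P x y)) ⇔ (x ≢ y)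
  T-≢ {x} {y} = mk⇔ (λ t → Equivalence.to T-not t ∘ Equivalence.from (T-isYes (x ≟ᶠ y)))
                    (λ x≢y → Equivalence.from T-not (x≢y ∘ Equivalence.to (T-isYes (x ≟ᶠ y))))

  T-comparable : ∀ {x y} → T (≼ᵇ P x y ∨ ≼ᵇ P y x) ⇔ Comparable x y
  T-comparable {x} {y} =
    mk⇔ (⊎.map (Equivalence.to (T-isYes (x ≼? y))) (Equivalence.to (T-isYes (y ≼? x))) ∘ Equivalence.to T-∨)
        (Equivalence.from T-∨ ∘ ⊎.map (Equivalence.from (T-isYes (x ≼? y))) (Equivalence.from (T-isYes (y ≼? x))))

  isFace⇔face : ∀ G → IsFace P G ⇔ Face G
  isFace⇔face G = ⇔-trans
    (T-all-∈ G _ λ x → ⇔-trans T-∧ (T-≢ ×-⇔ ⇔-trans T-∧ (T-≢ ×-⇔ T-all-∈ G _ (λ y → T-comparable))))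
    (mk⇔ (λ face → (λ {h} h∈G → (0̂-min h , proj₁ (face h h∈G) ∘ sym) , (1̂-max h , proj₁ (proj₂ (face h h∈G)))) ,
                   (λ h h′ h∈G → proj₂ (proj₂ (face h h∈G)) h′))
         (λ (bounds , chain) h h∈G →
           proj₂ (proj₁ (bounds h∈G)) ∘ sym , proj₂ (proj₂ (bounds h∈G)) , λ y → chain h y h∈G))

  disjoint⇔ : ∀ F G → T (disjointᵇ P F G) ⇔ G ⊆ ∁ F
  disjoint⇔ F G = mk⇔
    (λ t {x} x∈G → x∉p⇒x∈∁p λ x∈F → Equivalence.to T-not (Equivalence.to (T-and-allFin _) t x)
      (Equivalence.from T-∧ (Equivalence.to ∈⇔T-lookup x∈F , Equivalence.to ∈⇔T-lookup x∈G)))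
    (λ G⊆∁F → Equivalence.from (T-and-allFin (λ x → not (lookup F x ∧ lookup G x))) λ x →
      Equivalence.from T-not λ t →
      let x∈F , x∈G = Equivalence.to T-∧ t in
      x∈∁p⇒x∉p (G⊆∁F (Equivalence.from ∈⇔T-lookup x∈G)) (Equivalence.from ∈⇔T-lookup x∈F))

  inLink⇔ : ∀ F G → T (inLinkᵇ P F G) ⇔ (G ⊆ ∁ F × Face (F ∪ G))
  inLink⇔ F G = ⇔-trans T-∧ (disjoint⇔ F G ×-⇔ isFace⇔face (F ∪ G))

  sumℤ-allSubsets : ∀ m (g : Subset m → ℤ) → sumℤ (List.map g (allSubsets P m)) ≡ ∑ₛ m g
  sumℤ-allSubsets ℕ.zero  g = ℤ.+-identityʳ (g [])
  sumℤ-allSubsets (suc m) g = begin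
    sumℤ (List.map g (List.map (outside ∷_) A List.++ List.map (inside ∷_) A))
      ≡⟨ cong sumℤ (List.map-++ g (List.map (outside ∷_) A) _) ⟩
    sumℤ (List.map g (List.map (outside ∷_) A) ++ List.map g (List.map (inside ∷_) A))
      ≡⟨ sumℤ-++ (List.map g (List.map (outside ∷_) A)) _ ⟩
    sumℤ (List.map g (List.map (outside ∷_) A)) + sumℤ (List.map g (List.map (inside ∷_) A))
      ≡⟨ cong₂ _+_ (trans (cong sumℤ (sym (List.map-∘ A))) (sumℤ-allSubsets m (g ∘ (outside ∷_))))
                   (trans (cong sumℤ (sym (List.map-∘ A))) (sumℤ-allSubsets m (g ∘ (inside ∷_)))) ⟩
    ∑ₛ (suc m) g ∎
    where
    open ≡-Reasoning
    A = allSubsets P m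

  -- Adding 0̂ turns the faces G of the link of F into the chains of [0̂,1̂) through ⁅ 0̂ ⁆ ∪ F.
  module Link (0̂≺1̂ : 0̂ ≺ 1̂) {F : Subset n} (faceF : Face F) (G : Subset n) where

    K : Subset n
    K = ⁅ 0̂ ⁆ ∪ F

    F∪G⊆K∪G : F ∪ G ⊆ K ∪ G
    F∪G⊆K∪G h∈ = [ (λ h∈F → x∈p∪q⁺ (inj₁ (q⊆p∪q ⁅ 0̂ ⁆ F h∈F))) , q⊆p∪q K G ]′ (x∈p∪q⁻ F G h∈)

    inLink⇒chainThrough : G ⊆ ∁ F × Face (F ∪ G) → G ⊆ ∁ K × ChainThrough K 0̂ 1̂ (K ∪ G)
    inLink⇒chainThrough (G⊆∁F , bounds , chain) =
      (λ h∈G → x∉p⇒x∈∁p λ h∈K → [ (λ { refl → ≺-irrefl (proj₁ (bounds (q⊆p∪q F G h∈G))) })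
                                , x∈∁p⇒x∉p (G⊆∁F h∈G) ]′ (∈-⁅⁆∪⁻ h∈K)) ,
      p⊆p∪q G ,
      (λ h∈ → [ (λ { refl → ∈-[,⟩⁺ (≼-refl 0̂) 0̂≺1̂ }) , (λ h∈F∪G → ∈-[,⟩⁺ (0̂-min _) (proj₂ (bounds h∈F∪G))) ]′
              (∈-⁅⁆∪⁻ (reassociate h∈))) ,
      IsChain-⊆ reassociate (⁅⁆∪-isChain (λ {h} _ → inj₁ (0̂-min h)) chain)
      where
      reassociate : K ∪ G ⊆ ⁅ 0̂ ⁆ ∪ (F ∪ G)
      reassociate = ≡.subst (_ ∈_) (∪-assoc ⁅ 0̂ ⁆ F G)

    chainThrough⇒inLink : G ⊆ ∁ K × ChainThrough K 0̂ 1̂ (K ∪ G) → G ⊆ ∁ F × Face (F ∪ G)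
    chainThrough⇒inLink (G⊆∁K , _ , K∪G⊆ , chain) =
      (λ h∈G → x∉p⇒x∈∁p λ h∈F → x∈∁p⇒x∉p (G⊆∁K h∈G) (q⊆p∪q ⁅ 0̂ ⁆ F h∈F)) ,
      (λ h∈ → let 0̂≼h , h≺1̂ = ∈-[,⟩⁻ (K∪G⊆ (F∪G⊆K∪G h∈)) in (0̂≼h , h≢0̂ h∈ ∘ sym) , h≺1̂) ,
      IsChain-⊆ F∪G⊆K∪G chain
      where
      h≢0̂ : ∀ {h} → h ∈ F ∪ G → h ≢ 0̂
      h≢0̂ h∈ refl = [ ≺-irrefl ∘ proj₁ ∘ proj₁ faceF
                    , (λ 0̂∈G → x∈∁p⇒x∉p (G⊆∁K 0̂∈G) (x∈p∪q⁺ (inj₁ (x∈⁅x⁆ 0̂)))) ]′ (x∈p∪q⁻ F G h∈)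

    sgn-link : G ⊆ ∁ K × ChainThrough K 0̂ 1̂ (K ∪ G) → sgnℤ (+ ∣ G ∣ - + 1) ≡ - sgn (∣ K ∪ G ∣ ℕ.∸ ∣ K ∣)
    sgn-link (G⊆∁K , _) = trans (sgnℤ-pred (+ ∣ G ∣)) (cong (λ k → - sgn k) (sym (begin
      ∣ K ∪ G ∣ ℕ.∸ ∣ K ∣         ≡⟨ cong (ℕ._∸ ∣ K ∣) (∣∪∣-disjoint K G K⊆∁G) ⟩
      (∣ K ∣ ℕ.+ ∣ G ∣) ℕ.∸ ∣ K ∣ ≡⟨ ℕ.m+n∸m≡n ∣ K ∣ ∣ G ∣ ⟩
      ∣ G ∣                       ∎)))
      where
      open ≡-Reasoning
      K⊆∁G : K ⊆ ∁ G
      K⊆∁G h∈K = x∉p⇒x∈∁p λ h∈G → x∈∁p⇒x∉p (G⊆∁K h∈G) h∈K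

    linkSign≡ : when (T? (inLinkᵇ P F G)) (sgnℤ (+ ∣ G ∣ - + 1)) ≡
                when (G ⊆? ∁ K) (- chainSign K 0̂ 1̂ (K ∪ G))
    linkSign≡ = begin
      when (T? (inLinkᵇ P F G)) (sgnℤ (+ ∣ G ∣ - + 1))
        ≡⟨ when-cong (T? (inLinkᵇ P F G)) ((G ⊆? ∁ K) ×-dec chainThrough? K 0̂ 1̂ (K ∪ G))
                     (inLink⇒chainThrough ∘ Equivalence.to (inLink⇔ F G))
                     (Equivalence.from (inLink⇔ F G) ∘ chainThrough⇒inLink)
                     (sgn-link ∘ inLink⇒chainThrough ∘ Equivalence.to (inLink⇔ F G)) ⟩
      when ((G ⊆? ∁ K) ×-dec chainThrough? K 0̂ 1̂ (K ∪ G)) (- sgn (∣ K ∪ G ∣ ℕ.∸ ∣ K ∣))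
        ≡⟨ when-when (G ⊆? ∁ K) (chainThrough? K 0̂ 1̂ (K ∪ G)) ⟨
      when (G ⊆? ∁ K) (when (chainThrough? K 0̂ 1̂ (K ∪ G)) (- sgn (∣ K ∪ G ∣ ℕ.∸ ∣ K ∣)))
        ≡⟨ cong (when (G ⊆? ∁ K)) (neg-when (chainThrough? K 0̂ 1̂ (K ∪ G))) ⟨
      when (G ⊆? ∁ K) (- chainSign K 0̂ 1̂ (K ∪ G)) ∎
      where open ≡-Reasoning

  χ̃lk≡-chainSum : 0̂ ≺ 1̂ → ∀ {F} → Face F → χ̃lk P F ≡ - chainSum (⁅ 0̂ ⁆ ∪ F) 0̂ 1̂
  χ̃lk≡-chainSum 0̂≺1̂ {F} faceF = begin
    χ̃lk P F
      ≡⟨ sumℤ-allSubsets n _ ⟩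
    ∑ₛ n (λ G → when (T? (inLinkᵇ P F G)) (sgnℤ (+ ∣ G ∣ - + 1)))
      ≡⟨ ∑ₛ-cong n (Link.linkSign≡ 0̂≺1̂ faceF) ⟩
    ∑ₛ n (λ G → when (G ⊆? ∁ K) (- chainSign K 0̂ 1̂ (K ∪ G)))
      ≡⟨ ∑ₛ-∪ n K (-_ ∘ chainSign K 0̂ 1̂) ⟩
    ∑ₛ n (λ H → when (K ⊆? H) (- chainSign K 0̂ 1̂ H))
      ≡⟨ ∑ₛ-cong n (λ H → trans (cong (when (K ⊆? H)) (neg-when (chainThrough? K 0̂ 1̂ H)))
                         (trans (when-implied (chainThrough? K 0̂ 1̂ H) (K ⊆? H) proj₁)
                                (sym (neg-when (chainThrough? K 0̂ 1̂ H))))) ⟩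
    ∑ₛ n (λ H → - chainSign K 0̂ 1̂ H)
      ≡⟨ neg-∑ₛ n (chainSign K 0̂ 1̂) ⟨
    - chainSum K 0̂ 1̂ ∎
    where
    open ≡-Reasoning
    K = ⁅ 0̂ ⁆ ∪ F

  ∣fromList∣ : ∀ {x C y} → StrictChain P x C y → ∣ fromList C ∣ ≡ length C
  ∣fromList∣ {C = []}    _         = ∣⊥∣≡0 n
  ∣fromList∣ {C = c ∷ C} (_ , c…y) =
    trans (∣∪∣-disjoint ⁅ c ⁆ (fromList C) c∉C) (cong₂ ℕ._+_ (∣⁅x⁆∣≡1 c) (∣fromList∣ c…y))
    where
    c∉C : ⁅ c ⁆ ⊆ ∁ (fromList C)
    c∉C h∈⁅c⁆ = x∉p⇒x∈∁p λ h∈C → ≺-irrefl (≡.subst (c ≺_) (x∈⁅y⁆⇒x≡y c h∈⁅c⁆) (proj₁ (chain-bounds c…y h∈C)))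

  chain⇒face : ∀ {C} → StrictChain P 0̂ C 1̂ → Face (fromList C)
  chain⇒face {C} 0̂…1̂ = chain-bounds 0̂…1̂ , IsChain-⊆ (q⊆p∪q ⁅ 0̂ ⁆ (fromList C)) (chain-isChain 0̂…1̂)

  above-minimum : ∀ {F m y} → m ∈ F → (∀ {z} → z ∈ F → z ≼ m → z ≡ m) → (∀ {h} → h ∈ F → h ≺ y) → IsChain F →
                  ∀ {h} → h ∈ F ─ ⁅ m ⁆ → m ≺ h × h ≺ y
  above-minimum {F} {m} m∈F least below chain {h} h∈ =
    [ (λ h≼m → ⊥-elim (h≢m (least h∈F h≼m))) , (λ m≼h → m≼h , h≢m ∘ sym) ]′ (chain h m h∈F m∈F) , below h∈F
    where
    h∈F = p─q⊆p F ⁅ m ⁆ h∈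
    h≢m = x∉⁅y⁆⇒x≢y (∈─⇒∉ F ⁅ m ⁆ h∈)

  sortChain : ∀ {x y F} → x ≺ y → (∀ {h} → h ∈ F → x ≺ h × h ≺ y) → IsChain F →
              ∃[ C ] StrictChain P x C y × fromList C ≡ F
  sortChain {y = y} {F} = go (ℕ.<-wellFounded ∣ F ∣)
    where
    go : ∀ {x F} → Acc ℕ._<_ ∣ F ∣ → x ≺ y → (∀ {h} → h ∈ F → x ≺ h × h ≺ y) → IsChain F →
         ∃[ C ] StrictChain P x C y × fromList C ≡ F
    go {x} {F} (acc smaller) x≺y bounds chain with nonempty? F
    ... | no  empty    = [] , x≺y , sym (Empty-unique empty)
    ... | yes (h , h∈F) with minimal ≼-isPartialOrder _≼?_ (_∈? F) h∈F
    ...   | m , m∈F , least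
      with go (smaller (x∈p⇒∣p-x∣<∣p∣ m∈F)) (proj₂ (bounds m∈F))
              (above-minimum m∈F least (proj₂ ∘ bounds) chain) (IsChain-⊆ (p─q⊆p F ⁅ m ⁆) chain)
    ...     | C , m…y , C≡F-m =
      m ∷ C , (proj₁ (bounds m∈F) , m…y) , trans (cong (⁅ m ⁆ ∪_) C≡F-m) (⁅x⁆∪[p-x]≡p m∈F)

  -- The three conditions

  module OfRank (d : ℕ) (ρ1̂≡1+d : ρ 1̂ ≡ suc d) where

    len-0̂-1̂ : len 0̂ 1̂ ≡ suc d
    len-0̂-1̂ = cong₂ ℕ._∸_ ρ1̂≡1+d ρ-0̂

    0̂≺1̂ : 0̂ ≺ 1̂
    0̂≺1̂ = 0̂-min 1̂ , λ 0̂≡1̂ → ℕ.0≢1+n (trans (sym ρ-0̂) (trans (cong ρ 0̂≡1̂) ρ1̂≡1+d))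

    εP≡0⇔ : ∀ C → εP P d C ≡ 0ℤ ⇔ μChain P 0̂ C 1̂ ≡ sgn (len 0̂ 1̂)
    εP≡0⇔ C = mk⇔
      (λ ε≡0 → trans (ℤ.i-j≡0⇒i≡j _ _ (sgn-*-cancelˡ (length C) (trans ε≡0 (sym (ℤ.*-zeroʳ (sgn (length C)))))))
                     (cong sgn (sym len-0̂-1̂)))
      (λ μ≡ → trans (cong (sgn (length C) *_) (ℤ.i≡j⇒i-j≡0 (trans μ≡ (cong sgn len-0̂-1̂))))
                    (ℤ.*-zeroʳ (sgn (length C))))

    chainProducts⇔chainCondition : ∀ j t → j + 1ℤ ≡ + t → ChainProducts t ⇔ ChainCondition P d j
    chainProducts⇔chainCondition j t j+1≡t = mk⇔
      (λ chains C 0̂…1̂ long →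
        Equivalence.from (εP≡0⇔ C) (chains 0̂…1̂ (ℕ.≤-pred (ℤ.drop‿+<+ (≡.subst (ℤ._< _) j+1≡t long)))))
      (λ cond {C} 0̂…1̂ t≤|C| →
        Equivalence.to (εP≡0⇔ C) (cond C 0̂…1̂ (≡.subst (ℤ._< _) (sym j+1≡t) (ℤ.+<+ (ℕ.s≤s t≤|C|)))))

    sing⇔chainCondition : ∀ {j} → -[1+ 0 ] ≤ j → Sing P j ⇔ ChainCondition P d j
    sing⇔chainCondition { -[1+ 0 ]} _ =
      eulerianInt⇔eulerian ⟨ ⇔-trans ⟩ eulerian⇔chainProducts 0 ⟨ ⇔-trans ⟩ chainProducts⇔chainCondition -[1+ 0 ] 0 refl
    sing⇔chainCondition { -[1+ suc _ ]} (ℤ.-≤- ())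
    sing⇔chainCondition {+ k} _ =
      singK⇔eulerianCodim k ⟨ ⇔-trans ⟩ eulerianCodim⇔eulerian (suc k) ⟨ ⇔-trans ⟩ eulerian⇔chainProducts (suc k)
        ⟨ ⇔-trans ⟩ chainProducts⇔chainCondition (+ k) (suc k) (cong +_ (ℕ.+-comm k 1))

    εΔ-fromList : ∀ {C} → StrictChain P 0̂ C 1̂ → εΔ P d (fromList C) ≡ εP P d C
    εΔ-fromList {C} 0̂…1̂ = begin
      χ̃lk P (fromList C) - sgnℤ (+ d - + 1 - + ∣ fromList C ∣)
        ≡⟨ cong₂ _-_ (trans (χ̃lk≡-chainSum 0̂≺1̂ (chain⇒face 0̂…1̂)) (cong -_ (chainSum-fromList 0̂…1̂)))
                     (trans (cong (λ c → sgnℤ (+ d - + 1 - + c)) (∣fromList∣ 0̂…1̂))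
                            (trans (sgnℤ-∸ (+ d - + 1) k) (cong (_* sgn k) (sgnℤ-pred (+ d))))) ⟩
      - (- sgn k * μChain P 0̂ C 1̂) - (- sgn d * sgn k)
        ≡⟨ rearrange (sgn k) (μChain P 0̂ C 1̂) (sgn d) ⟩
      sgn k * (μChain P 0̂ C 1̂ - - sgn d) ∎
      where
      open ≡-Reasoning
      k = length C
      rearrange : ∀ s m t → - (- s * m) - (- t * s) ≡ s * (m - - t)
      rearrange = solve 3 (λ s m t → (:- ((:- s) :* m)) :- ((:- t) :* s) := s :* (m :- (:- t))) refl
        where open +-*-Solver

    jSingular⇔chainCondition : ∀ {j} → -[1+ 0 ] ≤ j → JSingularOP P d j ⇔ ChainCondition P d j
    jSingular⇔chainCondition {j} -1≤j = mk⇔ to from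
      where
      open ≡-Reasoning
      to : JSingularOP P d j → ChainCondition P d j
      to singular C 0̂…1̂ long = begin
        εP P d C            ≡⟨ εΔ-fromList 0̂…1̂ ⟨
        εΔ P d (fromList C) ≡⟨ singular (fromList C) (Equivalence.from (isFace⇔face (fromList C)) (chain⇒face 0̂…1̂))
                                 (≡.subst (λ c → j ≤ + c - 1ℤ) (sym (∣fromList∣ 0̂…1̂))
                                          (Equivalence.from (dim≥⇔length> -1≤j (length C)) long)) ⟩
        0ℤ                  ∎
      from : ChainCondition P d j → JSingularOP P d j
      from cond F isFace big with sortChain 0̂≺1̂ (proj₁ (Equivalence.to (isFace⇔face F) isFace))
                                               (proj₂ (Equivalence.to (isFace⇔face F) isFace))
      ... | C , 0̂…1̂ , refl = begin
        εΔ P d (fromList C) ≡⟨ εΔ-fromList 0̂…1̂ ⟩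
        εP P d C            ≡⟨ cond C 0̂…1̂ (Equivalence.to (dim≥⇔length> -1≤j (length C))
                                 (≡.subst (λ c → j ≤ + c - 1ℤ) (∣fromList∣ 0̂…1̂) big)) ⟩
        0ℤ                  ∎

proposition6p5 : (P : FinGradedPoset) (d : ℕ) →
    FinGradedPoset.ρ P (FinGradedPoset.1̂ P) ≡ suc d →
    (j : ℤ) → -[1+ 0 ] ≤ j →
    (Sing P j ⇔ JSingularOP P d j) × (Sing P j ⇔ ChainCondition P d j)
proposition6p5 P d ρ1̂≡1+d j -1≤j =
  ⇔-trans (sing⇔chainCondition -1≤j) (⇔-sym (jSingular⇔chainCondition -1≤j)) , sing⇔chainCondition -1≤j
  where open Graded.OfRank P d ρ1̂≡1+d
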